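{- Let $m\ge1$, $k\ge1$ and $h\le k-1$ be integers. The generating function for the number of partitions $\lambda$ of $n$ into distinct parts with an $h$-fixed hook in the $m$th column that arises from a hook of size $k$ (i.e. the row $s=k-h$ satisfies $\lambda_s\ge m$ and $h_{s,m}(\lambda)=k$) is \[ \sum_{l=\lceil (k+1)/2\rceil}^{k}\frac{q^{k+l(k-h-1)+(m-1)(2k-h-l)+\binom{k-h}{2}+\binom{k-l}{2}}\,(-q;q)_{m-1}}{(q;q)_{k-h-1}}\binom{l-1}{k-l}_q . \]
   Context: For a partition $\lambda$ with conjugate $\lambda'$, $h_{i,j}(\lambda)=\lambda_i+\lambda'_j-i-j+1$ is the hook length of cell $(i,j)$, $j\le\lambda_i$. An $h$-fixed hook in the $m$th column is a row $i$ with $\lambda_i\ge m$ and $h_{i,m}(\lambda)=i+h$. Notation: $(a;b)_n=\prod_{t=0}^{n-1}(1-ab^t)$, $\binom{a}{b}_q=\frac{(q;q)_a}{(q;q)_b(q;q)_{a-b}}$, and $\binom{x}{2}=x(x-1)/2$. -}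

module Defs where

open import Data.Bool using (Bool; true; false; _∧_; if_then_else_; T)
open import Data.Nat as ℕ using (ℕ; zero; suc; _∸_; _≤ᵇ_; _<ᵇ_; _≡ᵇ_; _%_; _/_)
open import Data.Nat.Combinatorics using (_C_)
open import Data.List using (List; []; _∷_; foldr; map; upTo)
open import Data.Nat.ListAction using (sum)
open import Data.Integer as ℤ using (ℤ; +_; ∣_∣)

-- Formal power series in q over ℤ : coefficient functions.

PS : Set
PS = ℕ → ℤ

sumTo : ℕ → (ℕ → ℤ) → ℤ
sumTo zero    f = f zero
sumTo (suc n) f = sumTo n f ℤ.+ f (suc n)

infixl 7 _⊛_
_⊛_ : PS → PS → PS
(f ⊛ g) n = sumTo n (λ i → f i ℤ.* g (n ∸ i))

infixl 6 _⊕_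
_⊕_ : PS → PS → PS
(f ⊕ g) n = f n ℤ.+ g n

zeroPS : PS
zeroPS _ = + 0

qpow : ℕ → PS
qpow a n = if a ≡ᵇ n then + 1 else + 0

onePS : PS
onePS = qpow 0

oneMinusQ : ℕ → PS
oneMinusQ t n = qpow 0 n ℤ.- qpow t n

onePlusQ : ℕ → PS
onePlusQ t n = qpow 0 n ℤ.+ qpow t n

-- 1/(1 - q^(i+1)) as a power series: the geometric series Σ_j q^{(i+1) j}
invOneMinusQ : ℕ → PS
invOneMinusQ i n = if n % suc i ≡ᵇ 0 then + 1 else + 0

prodPS : ℕ → (ℕ → PS) → PS
prodPS zero    F = onePS
prodPS (suc r) F = prodPS r F ⊛ F r

qqPoch : ℕ → PS
qqPoch r = prodPS r (λ t → oneMinusQ (suc t))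

invQQPoch : ℕ → PS
invQQPoch r = prodPS r (λ t → invOneMinusQ t)

negQQPoch : ℕ → PS
negQQPoch r = prodPS r (λ t → onePlusQ (suc t))

qBinom : ℕ → ℕ → PS
qBinom a b = qqPoch a ⊛ invQQPoch b ⊛ invQQPoch (a ∸ b)

sumPS : List ℕ → (ℕ → PS) → PS
sumPS ls F = foldr (λ l acc → F l ⊕ acc) zeroPS ls

range : ℕ → ℕ → List ℕ
range lo hi = map (λ i → lo ℕ.+ i) (upTo (suc hi ∸ lo))

-- Partitions as lists of parts, largest first: λ = (λ₁, λ₂, ...).

isDistinctPartition : List ℕ → Bool
isDistinctPartition []            = true
isDistinctPartition (x ∷ [])      = 0 <ᵇ x
isDistinctPartition (x ∷ y ∷ xs)  = (y <ᵇ x) ∧ isDistinctPartition (y ∷ xs)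

-- λ_i (1-indexed, 0 beyond the length)
part : List ℕ → ℕ → ℕ
part []       _             = 0
part (x ∷ xs) zero          = 0
part (x ∷ xs) (suc zero)    = x
part (x ∷ xs) (suc (suc i)) = part xs (suc i)

conj : List ℕ → ℕ → ℕ
conj λs j = sum (map (λ x → if j ≤ᵇ x then 1 else 0) λs)

-- hook length h_{i,j}(λ) = λ_i + λ'_j - i - j + 1, for a cell (i,j) with j ≤ λ_i
-- (then i ≤ λ'_j, so the truncated subtractions below are exact)
hookLength : List ℕ → ℕ → ℕ → ℕ
hookLength λs i j = (part λs i ∸ j) ℕ.+ (conj λs j ∸ i) ℕ.+ 1

-- the row s = k - h  (for h ≤ k - 1 this is a positive integer)
rowIdx : ℕ → ℤ → ℕ
rowIdx k h = ∣ + k ℤ.- h ∣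

goodPartition : ℕ → ℕ → ℤ → ℕ → List ℕ → Bool
goodPartition m k h n λs =
  isDistinctPartition λs ∧ (sum λs ≡ᵇ n) ∧ (1 ≤ᵇ rowIdx k h) ∧
  (m ≤ᵇ part λs (rowIdx k h)) ∧ (hookLength λs (rowIdx k h) m ≡ᵇ k)

-- The right-hand side series.  With s = k - h (so 2k - h - l = k + s - l):
-- exponent  k + l(k-h-1) + (m-1)(2k-h-l) + C(k-h,2) + C(k-l,2)

expo : ℕ → ℕ → ℕ → ℕ → ℕ
expo m k s l = k ℕ.+ l ℕ.* (s ∸ 1) ℕ.+ (m ∸ 1) ℕ.* (k ℕ.+ s ∸ l)
               ℕ.+ (s C 2) ℕ.+ ((k ∸ l) C 2)

rhsSeries : ℕ → ℕ → ℤ → PS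
rhsSeries m k h =
  sumPS (range ((k ℕ.+ 2) / 2) k) λ l →
    qpow (expo m k (rowIdx k h) l) ⊛ negQQPoch (m ∸ 1)
      ⊛ invQQPoch (rowIdx k h ∸ 1) ⊛ qBinom (l ∸ 1) (k ∸ l)

{-# OPTIONS --safe #-}
-- A distinct partition λ with λ_s = x ≥ m and h_{s,m}(λ) = k splits uniquely as
--   top ++ x ∷ mid ++ tail,
-- where top are the s - 1 parts above x, mid the parts in [m, x) and tail the parts below m.
-- With l = x - m + 1 the arm of the hook is l - 1 and its leg is |mid|, so the hook condition
-- reads |mid| = k - l; as mid lies in an interval of l - 1 integers, k - l ≤ l - 1, i.e.
-- l ≥ ⌈(k+1)/2⌉.  For fixed l the blocks are independent: x contributes q^x, tail (-q;q)_{m-1},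
-- top q^{(s-1)(x+1) + C(s-1,2)} / (q;q)_{s-1} (via the gaps between consecutive parts), and
-- mid q^{(k-l)m + C(k-l,2)} [l-1 choose k-l]_q (as a (k-l)-subset of an interval of length l-1).
-- Their product is the l-th summand.
module Submission where

open import Defs
open import Data.Nat as ℕ using (ℕ; zero; suc; _∸_; _≤_; _<_; z≤n; s≤s; _≡ᵇ_; _≤ᵇ_; _<ᵇ_; _%_; _/_)
import Data.Nat.Properties as ℕP
import Data.Nat.DivMod as ℕD
open import Data.Nat.Combinatorics using (_C_; nC1≡n; nCk+nC[k+1]≡[n+1]C[k+1])
open import Data.Nat.ListAction using (sum)
open import Data.Nat.ListAction.Properties using (sum-++)
import Data.Nat.Solver as ℕSolver
open import Data.Integer as ℤ using (ℤ; +_; -[1+_]; _+_; _*_; -_)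
import Data.Integer.Properties as ℤP
open import Data.Fin as Fin using (Fin)
import Data.Fin.Properties as FinP
open import Data.List using (List; []; _∷_; length; _++_; map; applyUpTo; takeWhile; dropWhile)
open import Data.List.Properties using (∷-injectiveˡ; map-++; takeWhile++dropWhile)
open import Data.Bool using (Bool; true; false; T; _∧_; if_then_else_)
open import Data.Bool.Properties using (T-irrelevant; T-∧)
open import Data.Product using (Σ; _×_; _,_; proj₁; proj₂)
open import Data.Sum using (_⊎_; inj₁; inj₂; [_,_]′)
open import Data.Sum.Function.Propositional using (_⊎-↔_)
open import Data.Product.Function.NonDependent.Propositional using (_×-↔_)
open import Data.Unit using (⊤; tt)
open import Data.Empty using (⊥-elim)
open import Data.Maybe using (Maybe; just; nothing)
open import Function using (_∘_)
open import Function.Bundles using (_↔_; Inverse; Injection; Equivalence; mk↔ₛ′)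
open import Function.Properties.Inverse using (↔-refl; ↔-sym; ↔-trans; ↔⇒↣)
open import Relation.Nullary using (yes; no; ¬_; ofʸ; ofⁿ)
import Relation.Unary
open import Relation.Binary.PropositionalEquality
open import Relation.Binary.Structures using (IsEquivalence)
open import Algebra.Bundles using (CommutativeRing)
open import Algebra.Structures using (IsCommutativeRing)
open import Algebra.Properties.CommutativeSemigroup ℤP.+-commutativeSemigroup using (interchange)
open import Algebra.Solver.Ring.AlmostCommutativeRing using (fromCommutativeRing; _-Raw-AlmostCommutative⟶_)
import Relation.Binary.Reasoning.Setoid as SetoidReasoning
open ℕSolver.+-*-Solver using () renaming (solve to ℕsolve; _:=_ to _:=ℕ_; _:+_ to _:+ℕ_; _:*_ to _:*ℕ_; con to conℕ)

infix 4 _≋_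
_≋_ : PS → PS → Set
f ≋ g = ∀ n → f n ≡ g n

≡⇒≋ : ∀ {f g : PS} → f ≡ g → f ≋ g
≡⇒≋ refl _ = refl

sumTo-cong≤ : ∀ n {f g : ℕ → ℤ} → (∀ i → i ≤ n → f i ≡ g i) → sumTo n f ≡ sumTo n g
sumTo-cong≤ zero    e = e 0 z≤n
sumTo-cong≤ (suc n) e = cong₂ _+_ (sumTo-cong≤ n (λ i p → e i (ℕP.m≤n⇒m≤1+n p))) (e (suc n) ℕP.≤-refl)

sumTo-cong : ∀ n {f g : ℕ → ℤ} → (∀ i → f i ≡ g i) → sumTo n f ≡ sumTo n g
sumTo-cong n e = sumTo-cong≤ n (λ i _ → e i)

sumTo-+ : ∀ n (f g : ℕ → ℤ) → sumTo n (λ i → f i + g i) ≡ sumTo n f + sumTo n g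
sumTo-+ zero    f g = refl
sumTo-+ (suc n) f g =
  trans (cong (_+ (f (suc n) + g (suc n))) (sumTo-+ n f g)) (interchange (sumTo n f) (sumTo n g) _ _)

sumTo-*ˡ : ∀ n c (f : ℕ → ℤ) → c * sumTo n f ≡ sumTo n (λ i → c * f i)
sumTo-*ˡ zero    c f = refl
sumTo-*ˡ (suc n) c f = trans (ℤP.*-distribˡ-+ c (sumTo n f) _) (cong (_+ c * f (suc n)) (sumTo-*ˡ n c f))

sumTo-*ʳ : ∀ n c (f : ℕ → ℤ) → sumTo n f * c ≡ sumTo n (λ i → f i * c)
sumTo-*ʳ n c f =
  trans (ℤP.*-comm (sumTo n f) c) (trans (sumTo-*ˡ n c f) (sumTo-cong n (λ i → ℤP.*-comm c (f i))))

sumTo-suc : ∀ n (f : ℕ → ℤ) → sumTo (suc n) f ≡ f 0 + sumTo n (f ∘ suc)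
sumTo-suc zero    f = refl
sumTo-suc (suc n) f =
  trans (cong (_+ f (suc (suc n))) (sumTo-suc n f)) (ℤP.+-assoc (f 0) _ _)

sumTo-zero≤ : ∀ n (f : ℕ → ℤ) → (∀ i → i ≤ n → f i ≡ + 0) → sumTo n f ≡ + 0
sumTo-zero≤ zero    f e = e 0 z≤n
sumTo-zero≤ (suc n) f e = cong₂ _+_ (sumTo-zero≤ n f (λ i p → e i (ℕP.m≤n⇒m≤1+n p))) (e (suc n) ℕP.≤-refl)

sumTo-zero : ∀ n (f : ℕ → ℤ) → (∀ i → f i ≡ + 0) → sumTo n f ≡ + 0
sumTo-zero n f e = sumTo-zero≤ n f (λ i _ → e i)

sumTo-single : ∀ n a (f : ℕ → ℤ) → a ≤ n → (∀ i → i ≢ a → f i ≡ + 0) → sumTo n f ≡ f a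
sumTo-single zero .zero f z≤n e = refl
sumTo-single (suc n) a f a≤ e with a ℕP.≟ suc n
... | yes refl = trans (cong (_+ f (suc n)) (sumTo-zero≤ n f (λ i i≤n → e i (λ { refl → ℕP.<-irrefl refl (s≤s i≤n) }))))
                       (ℤP.+-identityˡ _)
... | no a≢ = trans (cong₂ _+_ (sumTo-single n a f (ℕP.≤-pred (ℕP.≤∧≢⇒< a≤ a≢)) e) (e (suc n) (a≢ ∘ sym)))
                    (ℤP.+-identityʳ _)

sumTo-reverse : ∀ n (f : ℕ → ℤ) → sumTo n f ≡ sumTo n (λ i → f (n ∸ i))
sumTo-reverse zero    f = refl
sumTo-reverse (suc n) f = begin
  sumTo n f + f (suc n)                     ≡⟨ cong (_+ f (suc n)) (sumTo-reverse n f) ⟩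
  sumTo n (λ i → f (n ∸ i)) + f (suc n)     ≡⟨ ℤP.+-comm (sumTo n (λ i → f (n ∸ i))) _ ⟩
  f (suc n) + sumTo n (λ i → f (n ∸ i))     ≡⟨ sym (sumTo-suc n (λ i → f (suc n ∸ i))) ⟩
  sumTo (suc n) (λ i → f (suc n ∸ i))       ∎
  where open ≡-Reasoning

sumTo-triangle : ∀ n (F : ℕ → ℕ → ℤ) →
  sumTo n (λ i → sumTo i (F i)) ≡ sumTo n (λ j → sumTo (n ∸ j) (λ t → F (j ℕ.+ t) j))
sumTo-triangle zero    F = refl
sumTo-triangle (suc n) F = begin
  sumTo n (λ i → sumTo i (F i)) + (sumTo n (F (suc n)) + F (suc n) (suc n))
    ≡⟨ cong (_+ (sumTo n (F (suc n)) + F (suc n) (suc n))) (sumTo-triangle n F) ⟩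
  Rows n + (sumTo n (F (suc n)) + F (suc n) (suc n))
    ≡⟨ sym (ℤP.+-assoc (Rows n) _ _) ⟩
  (Rows n + sumTo n (F (suc n))) + F (suc n) (suc n)
    ≡⟨ cong (_+ F (suc n) (suc n)) (sym (sumTo-+ n _ _)) ⟩
  sumTo n (λ j → row n j + F (suc n) j) + F (suc n) (suc n)
    ≡⟨ cong₂ _+_ (sumTo-cong≤ n extendRow) (cong (λ z → F z (suc n)) (sym (ℕP.+-identityʳ (suc n)))) ⟩
  sumTo n (row (suc n)) + F (suc n ℕ.+ 0) (suc n)
    ≡⟨ cong (λ z → sumTo n (row (suc n)) + sumTo z (λ t → F (suc n ℕ.+ t) (suc n))) (sym (ℕP.n∸n≡0 n)) ⟩
  Rows (suc n) ∎
  where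
  open ≡-Reasoning
  row : ℕ → ℕ → ℤ
  row n j = sumTo (n ∸ j) (λ t → F (j ℕ.+ t) j)
  Rows : ℕ → ℤ
  Rows n = sumTo n (row n)
  extendRow : ∀ j → j ≤ n → row n j + F (suc n) j ≡ row (suc n) j
  extendRow j j≤n rewrite ℕP.+-∸-assoc 1 j≤n =
    cong (λ z → row n j + F z j) (trans (cong suc (sym (ℕP.m+[n∸m]≡n j≤n))) (sym (ℕP.+-suc j (n ∸ j))))

negPS : PS → PS
negPS f n = - f n

⊛-cong : ∀ {f f′ g g′} → f ≋ f′ → g ≋ g′ → f ⊛ g ≋ f′ ⊛ g′
⊛-cong ef eg n = sumTo-cong n (λ i → cong₂ _*_ (ef i) (eg (n ∸ i)))

⊕-cong : ∀ {f f′ g g′} → f ≋ f′ → g ≋ g′ → f ⊕ g ≋ f′ ⊕ g′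
⊕-cong ef eg n = cong₂ _+_ (ef n) (eg n)

⊛-comm : ∀ f g → f ⊛ g ≋ g ⊛ f
⊛-comm f g n = trans (sumTo-reverse n _) (sumTo-cong≤ n swap)
  where
  swap : ∀ i → i ≤ n → f (n ∸ i) * g (n ∸ (n ∸ i)) ≡ g i * f (n ∸ i)
  swap i i≤n = trans (cong (λ z → f (n ∸ i) * g z) (ℕP.m∸[m∸n]≡n i≤n)) (ℤP.*-comm (f (n ∸ i)) (g i))

⊛-assoc : ∀ f g h → (f ⊛ g) ⊛ h ≋ f ⊛ (g ⊛ h)
⊛-assoc f g h n = begin
  sumTo n (λ i → sumTo i (λ j → f j * g (i ∸ j)) * h (n ∸ i))
    ≡⟨ sumTo-cong n (λ i → sumTo-*ʳ i (h (n ∸ i)) _) ⟩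
  sumTo n (λ i → sumTo i (λ j → f j * g (i ∸ j) * h (n ∸ i)))
    ≡⟨ sumTo-triangle n (λ i j → f j * g (i ∸ j) * h (n ∸ i)) ⟩
  sumTo n (λ j → sumTo (n ∸ j) (λ t → f j * g (j ℕ.+ t ∸ j) * h (n ∸ (j ℕ.+ t))))
    ≡⟨ sumTo-cong n (λ j → sumTo-cong (n ∸ j) (reindex j)) ⟩
  sumTo n (λ j → sumTo (n ∸ j) (λ t → f j * (g t * h (n ∸ j ∸ t))))
    ≡⟨ sumTo-cong n (λ j → sym (sumTo-*ˡ (n ∸ j) (f j) _)) ⟩
  sumTo n (λ j → f j * sumTo (n ∸ j) (λ t → g t * h (n ∸ j ∸ t))) ∎
  where
  open ≡-Reasoning
  reindex : ∀ j t → f j * g (j ℕ.+ t ∸ j) * h (n ∸ (j ℕ.+ t)) ≡ f j * (g t * h (n ∸ j ∸ t))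
  reindex j t = trans (cong₂ (λ a b → f j * g a * h b) (ℕP.m+n∸m≡n j t) (sym (ℕP.∸-+-assoc n j t)))
                      (ℤP.*-assoc (f j) _ _)

⊛-identityˡ : ∀ f → onePS ⊛ f ≋ f
⊛-identityˡ f zero    = ℤP.*-identityˡ (f 0)
⊛-identityˡ f (suc n) = begin
  sumTo (suc n) (λ i → onePS i * f (suc n ∸ i))         ≡⟨ sumTo-suc n _ ⟩
  + 1 * f (suc n) + sumTo n (λ i → + 0 * f (n ∸ i))     ≡⟨ cong₂ _+_ (ℤP.*-identityˡ (f (suc n)))
                                                             (sumTo-zero n _ (λ i → ℤP.*-zeroˡ (f (n ∸ i)))) ⟩
  f (suc n) + + 0                                       ≡⟨ ℤP.+-identityʳ _ ⟩
  f (suc n)                                             ∎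
  where open ≡-Reasoning

⊛-distribˡ : ∀ f g h → f ⊛ (g ⊕ h) ≋ (f ⊛ g) ⊕ (f ⊛ h)
⊛-distribˡ f g h n =
  trans (sumTo-cong n (λ i → ℤP.*-distribˡ-+ (f i) (g (n ∸ i)) (h (n ∸ i)))) (sumTo-+ n _ _)

≋-isEquivalence : IsEquivalence _≋_
≋-isEquivalence = record
  { refl = λ _ → refl ; sym = λ e n → sym (e n) ; trans = λ e e′ n → trans (e n) (e′ n) }

PS-isCommutativeRing : IsCommutativeRing _≋_ _⊕_ _⊛_ negPS zeroPS onePS
PS-isCommutativeRing = record
  { isRing = record
    { +-isAbelianGroup = record
      { isGroup = record
        { isMonoid = record
          { isSemigroup = record
            { isMagma = record { isEquivalence = ≋-isEquivalence ; ∙-cong = ⊕-cong }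
            ; assoc = λ f g h n → ℤP.+-assoc (f n) (g n) (h n) }
          ; identity = (λ f n → ℤP.+-identityˡ (f n)) , (λ f n → ℤP.+-identityʳ (f n)) }
        ; inverse = (λ f n → ℤP.+-inverseˡ (f n)) , (λ f n → ℤP.+-inverseʳ (f n))
        ; ⁻¹-cong = λ e n → cong -_ (e n) }
      ; comm = λ f g n → ℤP.+-comm (f n) (g n) }
    ; *-cong = ⊛-cong
    ; *-assoc = ⊛-assoc
    ; *-identity = ⊛-identityˡ , (λ f n → trans (⊛-comm f onePS n) (⊛-identityˡ f n))
    ; distrib = ⊛-distribˡ , distribʳ }
  ; *-comm = ⊛-comm }
  where
  distribʳ : ∀ f g h → (g ⊕ h) ⊛ f ≋ (g ⊛ f) ⊕ (h ⊛ f)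
  distribʳ f g h n =
    trans (⊛-comm (g ⊕ h) f n) (trans (⊛-distribˡ f g h n) (cong₂ _+_ (⊛-comm f g n) (⊛-comm f h n)))

PS-commutativeRing : CommutativeRing _ _
PS-commutativeRing = record { isCommutativeRing = PS-isCommutativeRing }

open CommutativeRing PS-commutativeRing public
  using ()
  renaming ( setoid to PS-setoid; refl to ≋-refl; sym to ≋-sym; trans to ≋-trans
           ; +-identityˡ to ⊕-identityˡ; zeroʳ to ⊛-zeroʳ; *-identityʳ to ⊛-identityʳ)

⊛-congˡ : ∀ {f f′} g → f ≋ f′ → f ⊛ g ≋ f′ ⊛ g
⊛-congˡ {f} {f′} g e = ⊛-cong {f} {f′} {g} {g} e (λ _ → refl)

⊛-congʳ : ∀ f {g g′} → g ≋ g′ → f ⊛ g ≋ f ⊛ g′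
⊛-congʳ f {g} {g′} e = ⊛-cong {f} {f} {g} {g′} (λ _ → refl) e

⊕-congʳ : ∀ f {g g′} → g ≋ g′ → f ⊕ g ≋ f ⊕ g′
⊕-congʳ f {g} {g′} e = ⊕-cong {f} {f} {g} {g′} (λ _ → refl) e

constPS : ℤ → PS
constPS c zero    = c
constPS c (suc n) = + 0

constPS-homomorphism : ℤ.+-*-rawRing -Raw-AlmostCommutative⟶ fromCommutativeRing PS-commutativeRing
constPS-homomorphism = record
  { ⟦_⟧ = constPS
  ; +-homo = λ { a b zero → refl ; a b (suc n) → refl }
  ; *-homo = λ { a b zero → refl ; a b (suc n) → sym (*-homo-suc a b n) }
  ; -‿homo = λ { a zero → refl ; a (suc n) → refl }
  ; 0-homo = λ { zero → refl ; (suc n) → refl }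
  ; 1-homo = λ { zero → refl ; (suc n) → refl } }
  where
  *-homo-suc : ∀ a b n → (constPS a ⊛ constPS b) (suc n) ≡ + 0
  *-homo-suc a b n = trans (sumTo-suc n _)
    (cong₂ _+_ (ℤP.*-zeroʳ a) (sumTo-zero n _ (λ i → ℤP.*-zeroˡ (constPS b (n ∸ i)))))

constPS-≟ : ∀ a b → Maybe (constPS a ≋ constPS b)
constPS-≟ a b with a ℤ.≟ b
... | yes refl = just ≋-refl
... | no _     = nothing

open import Algebra.Solver.Ring ℤ.+-*-rawRing (fromCommutativeRing PS-commutativeRing) constPS-homomorphism constPS-≟
  using (solve; _:=_; _:+_; _:-_; _:*_; con)

constPS-one : constPS (+ 1) ≋ onePS
constPS-one zero    = refl
constPS-one (suc n) = refl

oneMinusQ≋ : ∀ t → oneMinusQ t ≋ constPS (+ 1) ⊕ negPS (qpow t)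
oneMinusQ≋ t = ⊕-cong {onePS} {constPS (+ 1)} {negPS (qpow t)} (≋-sym constPS-one) ≋-refl

qpow-diag : ∀ a → qpow a a ≡ + 1
qpow-diag a with a ≡ᵇ a in eq
... | true  = refl
... | false = ⊥-elim (subst T eq (ℕP.≡⇒≡ᵇ a a refl))

qpow-offDiag : ∀ a n → a ≢ n → qpow a n ≡ + 0
qpow-offDiag a n a≢n with a ≡ᵇ n in eq
... | true  = ⊥-elim (a≢n (ℕP.≡ᵇ⇒≡ a n (subst T (sym eq) tt)))
... | false = refl

qpow-cong : ∀ {a b} → a ≡ b → qpow a ≋ qpow b
qpow-cong refl = ≋-refl

qpow-+ : ∀ a b n → qpow (a ℕ.+ b) (a ℕ.+ n) ≡ qpow b n
qpow-+ zero    b n = refl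
qpow-+ (suc a) b n = qpow-+ a b n

qpow-⊛-shift : ∀ a (f : PS) n → (qpow a ⊛ f) (a ℕ.+ n) ≡ f n
qpow-⊛-shift a f n =
  trans (sumTo-single (a ℕ.+ n) a _ (ℕP.m≤m+n a n) vanish)
        (trans (cong₂ _*_ (qpow-diag a) (cong f (ℕP.m+n∸m≡n a n))) (ℤP.*-identityˡ (f n)))
  where
  vanish : ∀ i → i ≢ a → qpow a i * f (a ℕ.+ n ∸ i) ≡ + 0
  vanish i i≢a = trans (cong (_* f (a ℕ.+ n ∸ i)) (qpow-offDiag a i (i≢a ∘ sym))) (ℤP.*-zeroˡ (f (a ℕ.+ n ∸ i)))

qpow-⊛-below : ∀ a (f : PS) n → n < a → (qpow a ⊛ f) n ≡ + 0
qpow-⊛-below a f n n<a = sumTo-zero≤ n _ vanish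
  where
  vanish : ∀ i → i ≤ n → qpow a i * f (n ∸ i) ≡ + 0
  vanish i i≤n = trans (cong (_* f (n ∸ i)) (qpow-offDiag a i (λ { refl → ℕP.<-irrefl refl (ℕP.≤-<-trans i≤n n<a) })))
                       (ℤP.*-zeroˡ (f (n ∸ i)))

qpow-⊛-qpow : ∀ a b → qpow a ⊛ qpow b ≋ qpow (a ℕ.+ b)
qpow-⊛-qpow a b n with a ℕP.≤? n
... | yes a≤n = begin
    (qpow a ⊛ qpow b) n                  ≡⟨ cong (qpow a ⊛ qpow b) (sym (ℕP.m+[n∸m]≡n a≤n)) ⟩
    (qpow a ⊛ qpow b) (a ℕ.+ (n ∸ a))    ≡⟨ qpow-⊛-shift a (qpow b) (n ∸ a) ⟩
    qpow b (n ∸ a)                       ≡⟨ sym (qpow-+ a b (n ∸ a)) ⟩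
    qpow (a ℕ.+ b) (a ℕ.+ (n ∸ a))       ≡⟨ cong (qpow (a ℕ.+ b)) (ℕP.m+[n∸m]≡n a≤n) ⟩
    qpow (a ℕ.+ b) n                     ∎
  where open ≡-Reasoning
... | no a≰n = trans (qpow-⊛-below a (qpow b) n (ℕP.≰⇒> a≰n))
                     (sym (qpow-offDiag (a ℕ.+ b) n (λ { refl → a≰n (ℕP.m≤m+n a b) })))

qpow-split : ∀ a b {c} → a ℕ.+ b ≡ c → qpow c ≋ qpow a ⊛ qpow b
qpow-split a b e = ≋-sym (≋-trans (qpow-⊛-qpow a b) (qpow-cong e))

invOneMinusQ-recurrence : ∀ t → invOneMinusQ t ≋ onePS ⊕ (qpow (suc t) ⊛ invOneMinusQ t)
invOneMinusQ-recurrence t n with suc t ℕP.≤? n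
... | yes t<n = begin
    f n                                            ≡⟨ cong f (sym (ℕP.m+[n∸m]≡n t<n)) ⟩
    f (suc t ℕ.+ n′)                               ≡⟨ cong (λ z → if z ≡ᵇ 0 then + 1 else + 0) (shift-mod n′) ⟩
    f n′                                           ≡⟨ sym (qpow-⊛-shift (suc t) f n′) ⟩
    (qpow (suc t) ⊛ f) (suc t ℕ.+ n′)              ≡⟨ cong (qpow (suc t) ⊛ f) (ℕP.m+[n∸m]≡n t<n) ⟩
    (qpow (suc t) ⊛ f) n                           ≡⟨ sym (ℤP.+-identityˡ _) ⟩
    + 0 + (qpow (suc t) ⊛ f) n                     ≡⟨ cong (_+ (qpow (suc t) ⊛ f) n) (sym (qpow-offDiag 0 n 0≢n)) ⟩
    (onePS ⊕ (qpow (suc t) ⊛ f)) n                 ∎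
  where
  open ≡-Reasoning
  f = invOneMinusQ t
  n′ = n ∸ suc t
  0≢n : 0 ≢ n
  0≢n refl = ℕP.<-irrefl refl (ℕP.<-≤-trans (s≤s z≤n) t<n)
  shift-mod : ∀ n′ → (suc t ℕ.+ n′) % suc t ≡ n′ % suc t
  shift-mod n′ = trans (cong (_% suc t) (ℕP.+-comm (suc t) n′)) (ℕD.[m+n]%n≡m%n n′ (suc t))
... | no t≮n rewrite qpow-⊛-below (suc t) (invOneMinusQ t) n (ℕP.≰⇒> t≮n)
                   | ℕD.m<n⇒m%n≡m {n = suc t} {m = n} (ℕP.≰⇒> t≮n) with n
... | zero  = refl
... | suc _ = refl

invOneMinusQ-inverse : ∀ t → invOneMinusQ t ⊛ oneMinusQ (suc t) ≋ onePS
invOneMinusQ-inverse t = begin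
  f ⊛ (onePS ⊕ negPS Q)               ≈⟨ solve 3 (λ f o q → f :* (o :- q) := f :* o :- q :* f) ≋-refl f onePS Q ⟩
  (f ⊛ onePS) ⊕ negPS (Q ⊛ f)         ≈⟨ ⊕-cong {f ⊛ onePS} {f} {negPS (Q ⊛ f)} (⊛-identityʳ f) ≋-refl ⟩
  f ⊕ negPS (Q ⊛ f)                   ≈⟨ ⊕-cong {f} {onePS ⊕ (Q ⊛ f)} {negPS (Q ⊛ f)} (invOneMinusQ-recurrence t) ≋-refl ⟩
  (onePS ⊕ (Q ⊛ f)) ⊕ negPS (Q ⊛ f)   ≈⟨ solve 2 (λ o g → (o :+ g) :- g := o) ≋-refl onePS (Q ⊛ f) ⟩
  onePS                               ∎
  where
  open SetoidReasoning PS-setoid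
  f = invOneMinusQ t
  Q = qpow (suc t)

invQQPoch-inverse : ∀ r → invQQPoch r ⊛ qqPoch r ≋ onePS
invQQPoch-inverse zero    = ⊛-identityˡ onePS
invQQPoch-inverse (suc r) = begin
  (invQQPoch r ⊛ invOneMinusQ r) ⊛ (qqPoch r ⊛ oneMinusQ (suc r))
    ≈⟨ solve 4 (λ a b c d → (a :* b) :* (c :* d) := (a :* c) :* (b :* d)) ≋-refl
             (invQQPoch r) (invOneMinusQ r) (qqPoch r) (oneMinusQ (suc r)) ⟩
  (invQQPoch r ⊛ qqPoch r) ⊛ (invOneMinusQ r ⊛ oneMinusQ (suc r))
    ≈⟨ ⊛-cong (invQQPoch-inverse r) (invOneMinusQ-inverse r) ⟩
  onePS ⊛ onePS
    ≈⟨ ⊛-identityˡ onePS ⟩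
  onePS ∎
  where open SetoidReasoning PS-setoid

C2-suc : ∀ b → suc b C 2 ≡ b C 2 ℕ.+ b
C2-suc b = trans (sym (nCk+nC[k+1]≡[n+1]C[k+1] b 1)) (trans (cong (ℕ._+ b C 2) (nC1≡n b)) (ℕP.+-comm b (b C 2)))

-- The generating function, by sum, of the b-element subsets of {0, …, a-1}.
subsetSumGF : ℕ → ℕ → PS
subsetSumGF a       zero    = onePS
subsetSumGF zero    (suc b) = zeroPS
subsetSumGF (suc a) (suc b) = subsetSumGF a (suc b) ⊕ (qpow a ⊛ subsetSumGF a b)

subsetSumGF-vanishes : ∀ a b → a < b → subsetSumGF a b ≋ zeroPS
subsetSumGF-vanishes zero    (suc b) _         = ≋-refl
subsetSumGF-vanishes (suc a) (suc b) (s≤s a<b) = begin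
  subsetSumGF a (suc b) ⊕ (qpow a ⊛ subsetSumGF a b)   ≈⟨ ⊕-cong (subsetSumGF-vanishes a (suc b) (ℕP.m<n⇒m<1+n a<b))
                                                                  (⊛-congʳ (qpow a) (subsetSumGF-vanishes a b a<b)) ⟩
  zeroPS ⊕ (qpow a ⊛ zeroPS)                           ≈⟨ ⊕-identityˡ _ ⟩
  qpow a ⊛ zeroPS                                      ≈⟨ ⊛-zeroʳ (qpow a) ⟩
  zeroPS                                               ∎
  where open SetoidReasoning PS-setoid

SubsetSumClosedForm : ℕ → ℕ → Set
SubsetSumClosedForm a b = (qqPoch b ⊛ qqPoch (a ∸ b)) ⊛ subsetSumGF a b ≋ qpow (b C 2) ⊛ qqPoch a

qpow-C2-suc : ∀ b → qpow (suc b C 2) ≋ qpow (b C 2) ⊛ qpow b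
qpow-C2-suc b = qpow-split (b C 2) b (sym (C2-suc b))

closedForm-diagonal : ∀ b → SubsetSumClosedForm b b → SubsetSumClosedForm (suc b) (suc b)
closedForm-diagonal b ih = begin
  (qqPoch (suc b) ⊛ Z) ⊛ (subsetSumGF b (suc b) ⊕ (qpow b ⊛ subsetSumGF b b))
    ≈⟨ solve 6 (λ A U Z G₁ P G₀ → ((A :* U) :* Z) :* (G₁ :+ P :* G₀) := ((A :* U) :* Z) :* G₁ :+ (U :* P) :* ((A :* Z) :* G₀))
             ≋-refl (qqPoch b) U Z (subsetSumGF b (suc b)) (qpow b) (subsetSumGF b b) ⟩
  ((qqPoch (suc b) ⊛ Z) ⊛ subsetSumGF b (suc b)) ⊕ ((U ⊛ qpow b) ⊛ ((qqPoch b ⊛ Z) ⊛ subsetSumGF b b))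
    ≈⟨ ⊕-cong (≋-trans (⊛-congʳ (qqPoch (suc b) ⊛ Z) (subsetSumGF-vanishes b (suc b) (ℕP.n<1+n b))) (⊛-zeroʳ (qqPoch (suc b) ⊛ Z)))
              (⊛-congʳ (U ⊛ qpow b) ih) ⟩
  zeroPS ⊕ ((U ⊛ qpow b) ⊛ (qpow (b C 2) ⊛ qqPoch b))
    ≈⟨ ⊕-identityˡ _ ⟩
  (U ⊛ qpow b) ⊛ (qpow (b C 2) ⊛ qqPoch b)
    ≈⟨ solve 4 (λ U P X A → (U :* P) :* (X :* A) := (X :* P) :* (A :* U)) ≋-refl U (qpow b) (qpow (b C 2)) (qqPoch b) ⟩
  (qpow (b C 2) ⊛ qpow b) ⊛ (qqPoch b ⊛ U)
    ≈⟨ ⊛-congˡ (qqPoch (suc b)) (≋-sym (qpow-C2-suc b)) ⟩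
  qpow (suc b C 2) ⊛ qqPoch (suc b) ∎
  where
  open SetoidReasoning PS-setoid
  U = oneMinusQ (suc b)
  Z = qqPoch (b ∸ b)

-- With a = b + 1 + r the new terms cancel by
--   (1 - q^{r+1}) q^{C(b+1,2)} + (1 - q^{b+1}) q^a q^{C(b,2)} = q^{C(b+1,2)} (1 - q^{a+1}).
closedForm-pascal : ∀ a b → b < a → SubsetSumClosedForm a (suc b) → SubsetSumClosedForm a b →
                    SubsetSumClosedForm (suc a) (suc b)
closedForm-pascal a b b<a ih₁ ih₀ = begin
  (qqPoch (suc b) ⊛ qqPoch (a ∸ b)) ⊛ (G₁ ⊕ (qpow a ⊛ G₀))
    ≈⟨ ⊛-congˡ (G₁ ⊕ (qpow a ⊛ G₀)) (⊛-congʳ (qqPoch (suc b)) (≡⇒≋ (cong qqPoch a∸b≡))) ⟩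
  ((qqPoch b ⊛ Ub) ⊛ (qqPoch r ⊛ Ur)) ⊛ (G₁ ⊕ (qpow a ⊛ G₀))
    ≈⟨ solve 7 (λ A Ub R Ur G₁ P G₀ → ((A :* Ub) :* (R :* Ur)) :* (G₁ :+ P :* G₀)
                  := Ur :* (((A :* Ub) :* R) :* G₁) :+ (Ub :* P) :* ((A :* (R :* Ur)) :* G₀))
             ≋-refl (qqPoch b) Ub (qqPoch r) Ur G₁ (qpow a) G₀ ⟩
  (Ur ⊛ (((qqPoch b ⊛ Ub) ⊛ qqPoch r) ⊛ G₁)) ⊕ ((Ub ⊛ qpow a) ⊛ ((qqPoch b ⊛ (qqPoch r ⊛ Ur)) ⊛ G₀))
    ≈⟨ ⊕-cong (⊛-congʳ Ur ih₁)
              (⊛-congʳ (Ub ⊛ qpow a) (≋-trans (⊛-congˡ G₀ (⊛-congʳ (qqPoch b) (≡⇒≋ (cong qqPoch (sym a∸b≡))))) ih₀)) ⟩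
  (Ur ⊛ (qpow (suc b C 2) ⊛ qqPoch a)) ⊕ ((Ub ⊛ qpow a) ⊛ (X ⊛ qqPoch a))
    ≈⟨ ⊕-cong (⊛-cong (oneMinusQ≋ (suc r)) (⊛-congˡ (qqPoch a) (qpow-C2-suc b)))
              (⊛-congˡ (X ⊛ qqPoch a) (⊛-cong (≋-trans (oneMinusQ≋ (suc b)) (⊕-congʳ (constPS (+ 1)) (λ n → cong -_ (qpow-suc n))))
                                               qpow-a)) ⟩
  ((constPS (+ 1) ⊕ negPS D) ⊛ ((X ⊛ B) ⊛ qqPoch a)) ⊕ (((constPS (+ 1) ⊕ negPS (B ⊛ Q)) ⊛ (B ⊛ D)) ⊛ (X ⊛ qqPoch a))
    ≈⟨ solve 5 (λ X B D Q A → ((con (+ 1) :- D) :* ((X :* B) :* A)) :+ (((con (+ 1) :- B :* Q) :* (B :* D)) :* (X :* A))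
                  := (X :* B) :* (A :* (con (+ 1) :- (B :* D) :* Q)))
             ≋-refl X B D Q (qqPoch a) ⟩
  (X ⊛ B) ⊛ (qqPoch a ⊛ (constPS (+ 1) ⊕ negPS ((B ⊛ D) ⊛ Q)))
    ≈⟨ ⊛-cong (≋-sym (qpow-C2-suc b))
              (⊛-congʳ (qqPoch a) (≋-sym (≋-trans (oneMinusQ≋ (suc a)) (⊕-congʳ (constPS (+ 1)) (λ n → cong -_ (qpow-suc-a n)))))) ⟩
  qpow (suc b C 2) ⊛ (qqPoch a ⊛ oneMinusQ (suc a)) ∎
  where
  open SetoidReasoning PS-setoid
  G₁ = subsetSumGF a (suc b)
  G₀ = subsetSumGF a b
  r = a ∸ suc b
  a∸b≡ : a ∸ b ≡ suc r
  a∸b≡ = ℕP.+-∸-assoc 1 b<a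
  Ub = oneMinusQ (suc b)
  Ur = oneMinusQ (suc r)
  X = qpow (b C 2)
  B = qpow b
  D = qpow (suc r)
  Q = qpow 1
  b+r+1≡a : b ℕ.+ suc r ≡ a
  b+r+1≡a = trans (cong (b ℕ.+_) (sym a∸b≡)) (ℕP.m+[n∸m]≡n (ℕP.<⇒≤ b<a))
  qpow-suc : qpow (suc b) ≋ B ⊛ Q
  qpow-suc = qpow-split b 1 (ℕP.+-comm b 1)
  qpow-a : qpow a ≋ B ⊛ D
  qpow-a = qpow-split b (suc r) b+r+1≡a
  qpow-suc-a : qpow (suc a) ≋ (B ⊛ D) ⊛ Q
  qpow-suc-a = ≋-trans (qpow-split a 1 (ℕP.+-comm a 1)) (⊛-congˡ Q qpow-a)

subsetSumGF-closedForm : ∀ a b → b ≤ a → SubsetSumClosedForm a b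
subsetSumGF-closedForm a       zero    _ = ≋-trans (⊛-identityʳ (onePS ⊛ qqPoch a)) ≋-refl
subsetSumGF-closedForm (suc a) (suc b) (s≤s b≤a) with ℕP.m≤n⇒m<n∨m≡n b≤a
... | inj₂ refl = closedForm-diagonal b (subsetSumGF-closedForm b b ℕP.≤-refl)
... | inj₁ b<a  = closedForm-pascal a b b<a (subsetSumGF-closedForm a (suc b) b<a)
                                            (subsetSumGF-closedForm a b (ℕP.<⇒≤ b<a))

subsetSumGF≋qBinom : ∀ a b → b ≤ a → subsetSumGF a b ≋ qpow (b C 2) ⊛ qBinom a b
subsetSumGF≋qBinom a b b≤a = ≋-sym (begin
  X ⊛ ((qqPoch a ⊛ invQQPoch b) ⊛ invQQPoch (a ∸ b))
    ≈⟨ solve 4 (λ X A I J → X :* ((A :* I) :* J) := (X :* A) :* (I :* J)) ≋-refl X (qqPoch a) (invQQPoch b) (invQQPoch (a ∸ b)) ⟩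
  (X ⊛ qqPoch a) ⊛ (invQQPoch b ⊛ invQQPoch (a ∸ b))
    ≈⟨ ⊛-congˡ (invQQPoch b ⊛ invQQPoch (a ∸ b)) (≋-sym (subsetSumGF-closedForm a b b≤a)) ⟩
  ((qqPoch b ⊛ qqPoch (a ∸ b)) ⊛ G) ⊛ (invQQPoch b ⊛ invQQPoch (a ∸ b))
    ≈⟨ solve 5 (λ A B G I J → ((A :* B) :* G) :* (I :* J) := ((I :* A) :* (J :* B)) :* G) ≋-refl
             (qqPoch b) (qqPoch (a ∸ b)) G (invQQPoch b) (invQQPoch (a ∸ b)) ⟩
  ((invQQPoch b ⊛ qqPoch b) ⊛ (invQQPoch (a ∸ b) ⊛ qqPoch (a ∸ b))) ⊛ G
    ≈⟨ ⊛-congˡ G (⊛-cong (invQQPoch-inverse b) (invQQPoch-inverse (a ∸ b))) ⟩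
  (onePS ⊛ onePS) ⊛ G
    ≈⟨ ⊛-congˡ G (⊛-identityˡ onePS) ⟩
  onePS ⊛ G
    ≈⟨ ⊛-identityˡ G ⟩
  G ∎)
  where
  open SetoidReasoning PS-setoid
  X = qpow (b C 2)
  G = subsetSumGF a b

-- Validity is Boolean so that membership proofs are unique (see Fiber-≡).
record WeightedSet : Set₁ where
  constructor weightedSet
  field
    Elem   : Set
    valid  : Elem → Bool
    weight : Elem → ℕ
open WeightedSet public

Fiber : WeightedSet → ℕ → Set
Fiber W n = Σ (Elem W) λ a → T (valid W a) × (weight W a ≡ n)

Fiber-≡ : ∀ W {n} {a b : Elem W} {p q} {e : weight W a ≡ n} {e′ : weight W b ≡ n} →
          a ≡ b → _≡_ {A = Fiber W n} (a , p , e) (b , q , e′)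
Fiber-≡ W refl = cong₂ (λ p e → (_ , p , e)) (T-irrelevant _ _) (ℕP.≡-irrelevant _ _)

infix 4 _Enumerates_
_Enumerates_ : PS → WeightedSet → Set
f Enumerates W = ∀ n → Σ ℕ λ c → (f n ≡ + c) × (Fin c ↔ Fiber W n)

Fin-↔⇒≡ : ∀ {c d} → Fin c ↔ Fin d → c ≡ d
Fin-↔⇒≡ e = FinP.cantor-schröder-bernstein (Injection.injective (↔⇒↣ e)) (Injection.injective (↔⇒↣ (↔-sym e)))

enumerates-≋ : ∀ {f g W} → f Enumerates W → f ≋ g → g Enumerates W
enumerates-≋ E f≋g n = let (c , e , φ) = E n in c , trans (sym (f≋g n)) e , φ

record _≅_ (W V : WeightedSet) : Set where
  field
    to         : Elem W → Elem V
    from       : Elem V → Elem W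
    to-valid   : ∀ a → T (valid W a) → T (valid V (to a))
    from-valid : ∀ b → T (valid V b) → T (valid W (from b))
    to-weight  : ∀ a → T (valid W a) → weight V (to a) ≡ weight W a
    from∘to    : ∀ a → T (valid W a) → from (to a) ≡ a
    to∘from    : ∀ b → T (valid V b) → to (from b) ≡ b

Fiber-≅ : ∀ {W V} → W ≅ V → ∀ n → Fiber W n ↔ Fiber V n
Fiber-≅ {W} {V} I n = mk↔ₛ′
  (λ { (a , p , e) → to a , to-valid a p , trans (to-weight a p) e })
  (λ { (b , q , e) → from b , from-valid b q , trans (sym (to-weight (from b) (from-valid b q))) (trans (cong (weight V) (to∘from b q)) e) })
  (λ { (b , q , e) → Fiber-≡ V (to∘from b q) })
  (λ { (a , p , e) → Fiber-≡ W (from∘to a p) })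
  where open _≅_ I

enumerates-≅ : ∀ {f W V} → f Enumerates W → W ≅ V → f Enumerates V
enumerates-≅ E I n = let (c , e , φ) = E n in c , e , ↔-trans φ (Fiber-≅ I n)

point : ℕ → WeightedSet
point e = weightedSet ⊤ (λ _ → true) (λ _ → e)

qpow-enumerates : ∀ e → qpow e Enumerates point e
qpow-enumerates e n with e ℕP.≟ n
... | yes refl = 1 , qpow-diag e , mk↔ₛ′ (λ _ → tt , tt , refl) (λ _ → Fin.zero) (λ { (tt , tt , refl) → refl }) (λ { Fin.zero → refl ; (Fin.suc ()) })
... | no e≢n   = 0 , qpow-offDiag e n e≢n , mk↔ₛ′ (λ ()) (λ { (tt , _ , e′) → ⊥-elim (e≢n e′) }) (λ { (tt , _ , e′) → ⊥-elim (e≢n e′) }) (λ ())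

∅ʷ : WeightedSet
∅ʷ = weightedSet ⊤ (λ _ → false) (λ _ → 0)

zeroPS-enumerates : zeroPS Enumerates ∅ʷ
zeroPS-enumerates n = 0 , refl , mk↔ₛ′ (λ ()) (λ { (_ , () , _) }) (λ { (_ , () , _) }) (λ ())

infixr 1 _⊎ʷ_
_⊎ʷ_ : WeightedSet → WeightedSet → WeightedSet
W ⊎ʷ V = weightedSet (Elem W ⊎ Elem V) [ valid W , valid V ]′ [ weight W , weight V ]′

Fiber-⊎ : ∀ W V n → (Fiber W n ⊎ Fiber V n) ↔ Fiber (W ⊎ʷ V) n
Fiber-⊎ W V n = mk↔ₛ′
  (λ { (inj₁ (a , p , e)) → inj₁ a , p , e ; (inj₂ (b , p , e)) → inj₂ b , p , e })
  (λ { (inj₁ a , p , e) → inj₁ (a , p , e) ; (inj₂ b , p , e) → inj₂ (b , p , e) })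
  (λ { (inj₁ a , p , e) → refl ; (inj₂ b , p , e) → refl })
  (λ { (inj₁ (a , p , e)) → refl ; (inj₂ (b , p , e)) → refl })

enumerates-⊕ : ∀ {f g W V} → f Enumerates W → g Enumerates V → (f ⊕ g) Enumerates (W ⊎ʷ V)
enumerates-⊕ {W = W} {V} E D n =
  let (c , e , φ) = E n ; (d , e′ , ψ) = D n in
  c ℕ.+ d , cong₂ _+_ e e′ , ↔-trans (FinP.+↔⊎ {c} {d}) (↔-trans (φ ⊎-↔ ψ) (Fiber-⊎ W V n))

T-∧-intro : ∀ {a b} → T a → T b → T (a ∧ b)
T-∧-intro {a} {b} p q = Equivalence.from (T-∧ {a} {b}) (p , q)

T-∧-fst : ∀ {a b} → T (a ∧ b) → T a
T-∧-fst {a} {b} p = proj₁ (Equivalence.to (T-∧ {a} {b}) p)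

T-∧-snd : ∀ {a b} → T (a ∧ b) → T b
T-∧-snd {a} {b} p = proj₂ (Equivalence.to (T-∧ {a} {b}) p)

infixr 2 _×ʷ_
_×ʷ_ : WeightedSet → WeightedSet → WeightedSet
W ×ʷ V = weightedSet (Elem W × Elem V) (λ (a , b) → valid W a ∧ valid V b) (λ (a , b) → weight W a ℕ.+ weight V b)

BoundedΣ : ℕ → (ℕ → Set) → Set
BoundedΣ n X = Σ ℕ λ i → i ≤ n × X i

BoundedΣ-zero : ∀ X → X 0 ↔ BoundedΣ 0 X
BoundedΣ-zero X = mk↔ₛ′ (λ x → 0 , z≤n , x) (λ { (.0 , z≤n , x) → x }) (λ { (.0 , z≤n , x) → refl }) (λ _ → refl)

BoundedΣ-suc : ∀ X n → (BoundedΣ n X ⊎ X (suc n)) ↔ BoundedΣ (suc n) X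
BoundedΣ-suc X n = mk↔ₛ′ to from to∘from from∘to
  where
  to : BoundedΣ n X ⊎ X (suc n) → BoundedΣ (suc n) X
  to (inj₁ (i , i≤n , x)) = i , ℕP.m≤n⇒m≤1+n i≤n , x
  to (inj₂ x)             = suc n , ℕP.≤-refl , x
  split : ∀ i {i≤1+n : i ≤ suc n} → i < suc n ⊎ i ≡ suc n → X i → BoundedΣ n X ⊎ X (suc n)
  split i (inj₁ i<1+n) x = inj₁ (i , ℕP.≤-pred i<1+n , x)
  split i (inj₂ refl)  x = inj₂ x
  from : BoundedΣ (suc n) X → BoundedΣ n X ⊎ X (suc n)
  from (i , i≤1+n , x) = split i {i≤1+n} (ℕP.m≤n⇒m<n∨m≡n i≤1+n) x
  to∘from : ∀ y → to (from y) ≡ y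
  to∘from (i , i≤1+n , x) with ℕP.m≤n⇒m<n∨m≡n i≤1+n
  ... | inj₁ _    = cong (λ p → i , p , x) (ℕP.≤-irrelevant _ _)
  ... | inj₂ refl = cong (λ p → suc n , p , x) (ℕP.≤-irrelevant _ _)
  from∘to : ∀ y → from (to y) ≡ y
  from∘to (inj₁ (i , i≤n , x)) with ℕP.m≤n⇒m<n∨m≡n (ℕP.m≤n⇒m≤1+n i≤n)
  ... | inj₁ _    = cong (λ p → inj₁ (i , p , x)) (ℕP.≤-irrelevant _ _)
  ... | inj₂ refl = ⊥-elim (ℕP.<-irrefl refl i≤n)
  from∘to (inj₂ x) with ℕP.m≤n⇒m<n∨m≡n (ℕP.≤-refl {suc n})
  ... | inj₁ n<n  = ⊥-elim (ℕP.<-irrefl refl n<n)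
  ... | inj₂ refl = refl

BoundedΣ-cong : ∀ n {X Y : ℕ → Set} → (∀ i → X i ↔ Y i) → BoundedΣ n X ↔ BoundedΣ n Y
BoundedΣ-cong n e = mk↔ₛ′
  (λ (i , p , x) → i , p , Inverse.to (e i) x)
  (λ (i , p , y) → i , p , Inverse.from (e i) y)
  (λ (i , p , y) → cong (λ z → i , p , z) (Inverse.strictlyInverseˡ (e i) y))
  (λ (i , p , x) → cong (λ z → i , p , z) (Inverse.strictlyInverseʳ (e i) x))

sumToℕ : ℕ → (ℕ → ℕ) → ℕ
sumToℕ zero    h = h 0
sumToℕ (suc n) h = sumToℕ n h ℕ.+ h (suc n)

sumTo-pos : ∀ n h → sumTo n (λ i → + h i) ≡ + sumToℕ n h
sumTo-pos zero    h = refl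
sumTo-pos (suc n) h = cong (_+ + h (suc n)) (sumTo-pos n h)

Fin-sumToℕ : ∀ n h → Fin (sumToℕ n h) ↔ BoundedΣ n (Fin ∘ h)
Fin-sumToℕ zero    h = BoundedΣ-zero (Fin ∘ h)
Fin-sumToℕ (suc n) h =
  ↔-trans (FinP.+↔⊎ {sumToℕ n h}) (↔-trans (Fin-sumToℕ n h ⊎-↔ ↔-refl) (BoundedΣ-suc (Fin ∘ h) n))

Fiber-× : ∀ W V n → BoundedΣ n (λ i → Fiber W i × Fiber V (n ∸ i)) ↔ Fiber (W ×ʷ V) n
Fiber-× W V n = mk↔ₛ′ to from to∘from from∘to
  where
  to : BoundedΣ n (λ i → Fiber W i × Fiber V (n ∸ i)) → Fiber (W ×ʷ V) n
  to (i , i≤n , (a , p , ea) , (b , q , eb)) = (a , b) , T-∧-intro p q , trans (cong₂ ℕ._+_ ea eb) (ℕP.m+[n∸m]≡n i≤n)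
  from : Fiber (W ×ʷ V) n → BoundedΣ n (λ i → Fiber W i × Fiber V (n ∸ i))
  from ((a , b) , pq , e) =
    weight W a , subst (weight W a ≤_) e (ℕP.m≤m+n (weight W a) (weight V b)) ,
    (a , T-∧-fst pq , refl) ,
    (b , T-∧-snd {valid W a} pq , sym (trans (cong (_∸ weight W a) (sym e)) (ℕP.m+n∸m≡n (weight W a) (weight V b))))
  to∘from : ∀ y → to (from y) ≡ y
  to∘from ((a , b) , pq , e) = Fiber-≡ (W ×ʷ V) refl
  from∘to : ∀ y → from (to y) ≡ y
  from∘to (i , i≤n , (a , p , refl) , (b , q , eb)) =
    cong₂ (λ i≤n z → weight W a , i≤n , z) (ℕP.≤-irrelevant _ _) (cong₂ _,_ (Fiber-≡ W refl) (Fiber-≡ V refl))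

enumerates-⊛ : ∀ {f g W V} → f Enumerates W → g Enumerates V → (f ⊛ g) Enumerates (W ×ʷ V)
enumerates-⊛ {f} {g} {W} {V} E D n =
  sumToℕ n h , coefficient ,
  ↔-trans (Fin-sumToℕ n h) (↔-trans (BoundedΣ-cong n factor) (Fiber-× W V n))
  where
  h : ℕ → ℕ
  h i = proj₁ (E i) ℕ.* proj₁ (D (n ∸ i))
  coefficient : (f ⊛ g) n ≡ + sumToℕ n h
  coefficient = trans (sumTo-cong n (λ i → trans (cong₂ _*_ (proj₁ (proj₂ (E i))) (proj₁ (proj₂ (D (n ∸ i)))))
                                                 (sym (ℤP.pos-* (proj₁ (E i)) _))))
                      (sumTo-pos n h)
  factor : ∀ i → Fin (h i) ↔ (Fiber W i × Fiber V (n ∸ i))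
  factor i = ↔-trans (FinP.*↔× {proj₁ (E i)}) (proj₂ (proj₂ (E i)) ×-↔ proj₂ (proj₂ (D (n ∸ i))))

multiples : ℕ → WeightedSet
multiples t = weightedSet ℕ (λ _ → true) (λ d → d ℕ.* suc t)

invOneMinusQ-enumerates : ∀ t → invOneMinusQ t Enumerates multiples t
invOneMinusQ-enumerates t n with n % suc t ℕP.≟ 0
... | yes n%t≡0 = 1 , cong (λ r → if r ≡ᵇ 0 then + 1 else + 0) n%t≡0 , mk↔ₛ′
  (λ _ → n / suc t , tt , quotient)
  (λ _ → Fin.zero)
  (λ (d , tt , e) → Fiber-≡ (multiples t) (trans (cong (_/ suc t) (sym e)) (ℕD.m*n/n≡m d (suc t))))
  (λ { Fin.zero → refl ; (Fin.suc ()) })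
  where
  quotient : n / suc t ℕ.* suc t ≡ n
  quotient = sym (trans (ℕD.m≡m%n+[m/n]*n n (suc t)) (cong (ℕ._+ (n / suc t ℕ.* suc t)) n%t≡0))
... | no n%t≢0 = 0 , nonzero-remainder (n % suc t) n%t≢0 , mk↔ₛ′
  (λ ())
  (λ (d , _ , e) → ⊥-elim (n%t≢0 (multiple-mod d e)))
  (λ (d , _ , e) → ⊥-elim (n%t≢0 (multiple-mod d e)))
  (λ ())
  where
  nonzero-remainder : ∀ r → r ≢ 0 → (if r ≡ᵇ 0 then + 1 else + 0) ≡ + 0
  nonzero-remainder zero    r≢0 = ⊥-elim (r≢0 refl)
  nonzero-remainder (suc r) _   = refl
  multiple-mod : ∀ d → d ℕ.* suc t ≡ n → n % suc t ≡ 0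
  multiple-mod d e = trans (cong (_% suc t) (sym e)) (ℕD.m*n%n≡0 d (suc t))

prodPS′ : ℕ → (ℕ → PS) → PS
prodPS′ zero    F = onePS
prodPS′ (suc r) F = F 0 ⊛ prodPS′ r (F ∘ suc)

prodPS-suc : ∀ r F → prodPS (suc r) F ≋ F 0 ⊛ prodPS r (F ∘ suc)
prodPS-suc zero    F = ⊛-comm onePS (F 0)
prodPS-suc (suc r) F = ≋-trans (⊛-congˡ (F (suc r)) (prodPS-suc r F)) (⊛-assoc (F 0) (prodPS r (F ∘ suc)) (F (suc r)))

prodPS≋prodPS′ : ∀ r F → prodPS r F ≋ prodPS′ r F
prodPS≋prodPS′ zero    F = ≋-refl
prodPS≋prodPS′ (suc r) F = ≋-trans (prodPS-suc r F) (⊛-congʳ (F 0) (prodPS≋prodPS′ r (F ∘ suc)))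

-- The i-th entry is the multiplicity of the part o + 1 + i.
multiplicityWeight : ℕ → List ℕ → ℕ
multiplicityWeight o []       = 0
multiplicityWeight o (d ∷ ds) = d ℕ.* suc o ℕ.+ multiplicityWeight (suc o) ds

multiplicityLists : ℕ → ℕ → WeightedSet
multiplicityLists o r = weightedSet (List ℕ) (λ ds → length ds ≡ᵇ r) (multiplicityWeight o)

length≡0 : ∀ (ds : List ℕ) → T (length ds ≡ᵇ 0) → ds ≡ []
length≡0 [] _ = refl

singleton≅ : ∀ {W} (a₀ : Elem W) → weight W a₀ ≡ 0 → T (valid W a₀) → (∀ a → T (valid W a) → a ≡ a₀) → point 0 ≅ W
singleton≅ a₀ w₀ v₀ unique = record
  { to = λ _ → a₀ ; from = λ _ → tt ; to-valid = λ _ _ → v₀ ; from-valid = λ _ _ → tt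
  ; to-weight = λ _ _ → w₀ ; from∘to = λ _ _ → refl ; to∘from = λ a p → sym (unique a p) }

invOneMinusQ-product-enumerates : ∀ r o → prodPS′ r (λ t → invOneMinusQ (o ℕ.+ t)) Enumerates multiplicityLists o r
invOneMinusQ-product-enumerates zero    o = enumerates-≅ (qpow-enumerates 0) (singleton≅ [] refl tt length≡0)
invOneMinusQ-product-enumerates (suc r) o =
  enumerates-≅ (enumerates-≋ (enumerates-⊛ (invOneMinusQ-enumerates o) (invOneMinusQ-product-enumerates r (suc o)))
                             (⊛-cong (≡⇒≋ (cong invOneMinusQ (sym (ℕP.+-identityʳ o))))
                                     (prodPS′-cong r (λ t → ≡⇒≋ (cong invOneMinusQ (sym (ℕP.+-suc o t)))))))
               record
    { to = λ (d , ds) → d ∷ ds ; from = uncons ; to-valid = λ _ p → p ; from-valid = λ { (d ∷ ds) p → p ; [] () }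
    ; to-weight = λ _ _ → refl ; from∘to = λ _ _ → refl ; to∘from = λ { (d ∷ ds) _ → refl ; [] () } }
  where
  uncons : List ℕ → ℕ × List ℕ
  uncons []       = 0 , []
  uncons (d ∷ ds) = d , ds
  prodPS′-cong : ∀ r {F F′} → (∀ t → F t ≋ F′ t) → prodPS′ r F ≋ prodPS′ r F′
  prodPS′-cong zero    e = ≋-refl
  prodPS′-cong (suc r) e = ⊛-cong (e 0) (prodPS′-cong r (e ∘ suc))

descIn : ℕ → ℕ → List ℕ → Bool
descIn lo hi []       = true
descIn lo hi (y ∷ ys) = (lo ≤ᵇ y) ∧ ((y <ᵇ hi) ∧ descIn lo y ys)

descFrom : ℕ → List ℕ → Bool
descFrom lo []       = true
descFrom lo (y ∷ ys) = (lo ≤ᵇ y) ∧ descIn lo y ys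

descIn-∷⁻ : ∀ lo hi y ys → T (descIn lo hi (y ∷ ys)) → lo ≤ y × y < hi × T (descIn lo y ys)
descIn-∷⁻ lo hi y ys p =
  ℕP.≤ᵇ⇒≤ lo y (T-∧-fst p) , ℕP.<ᵇ⇒< y hi (T-∧-fst (T-∧-snd {lo ≤ᵇ y} p)) , T-∧-snd {y <ᵇ hi} (T-∧-snd {lo ≤ᵇ y} p)

descIn-∷⁺ : ∀ {lo hi y} ys → lo ≤ y → y < hi → T (descIn lo y ys) → T (descIn lo hi (y ∷ ys))
descIn-∷⁺ ys lo≤y y<hi p = T-∧-intro (ℕP.≤⇒≤ᵇ lo≤y) (T-∧-intro (ℕP.<⇒<ᵇ y<hi) p)

descFrom-∷⁻ : ∀ lo y ys → T (descFrom lo (y ∷ ys)) → lo ≤ y × T (descIn lo y ys)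
descFrom-∷⁻ lo y ys p = ℕP.≤ᵇ⇒≤ lo y (T-∧-fst p) , T-∧-snd {lo ≤ᵇ y} p

descFrom-∷⁺ : ∀ {lo y} ys → lo ≤ y → T (descIn lo y ys) → T (descFrom lo (y ∷ ys))
descFrom-∷⁺ ys lo≤y p = T-∧-intro (ℕP.≤⇒≤ᵇ lo≤y) p

fromGaps : ℕ → List ℕ → List ℕ
fromGaps lo []       = []
fromGaps lo (d ∷ ds) = (lo ℕ.+ length ds ℕ.+ d ℕ.+ sum ds) ∷ fromGaps lo ds

toGaps : ℕ → List ℕ → List ℕ
toGaps lo []           = []
toGaps lo (y ∷ [])     = (y ∸ lo) ∷ []
toGaps lo (y ∷ z ∷ zs) = (y ∸ suc z) ∷ toGaps lo (z ∷ zs)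

head-fromGaps-≥ : ∀ lo d ds → lo ≤ lo ℕ.+ length ds ℕ.+ d ℕ.+ sum ds
head-fromGaps-≥ lo d ds = ℕP.≤-trans (ℕP.m≤m+n lo (length ds)) (ℕP.≤-trans (ℕP.m≤m+n _ d) (ℕP.m≤m+n _ (sum ds)))

descIn-fromGaps : ∀ lo hi ds → lo ℕ.+ length ds ℕ.+ sum ds ≤ hi → T (descIn lo hi (fromGaps lo ds))
descIn-fromGaps lo hi []       _ = tt
descIn-fromGaps lo hi (d ∷ ds) ≤hi =
  descIn-∷⁺ (fromGaps lo ds) (head-fromGaps-≥ lo d ds) (ℕP.<-≤-trans (ℕP.≤-reflexive rearrange) ≤hi)
    (descIn-fromGaps lo _ ds (ℕP.+-monoˡ-≤ (sum ds) (ℕP.m≤m+n (lo ℕ.+ length ds) d)))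
  where
  rearrange : suc (lo ℕ.+ length ds ℕ.+ d ℕ.+ sum ds) ≡ lo ℕ.+ suc (length ds) ℕ.+ (d ℕ.+ sum ds)
  rearrange = ℕsolve 4 (λ lo l d s → conℕ 1 :+ℕ (lo :+ℕ l :+ℕ d :+ℕ s) :=ℕ lo :+ℕ (conℕ 1 :+ℕ l) :+ℕ (d :+ℕ s))
                       refl lo (length ds) d (sum ds)

descFrom-fromGaps : ∀ lo ds → T (descFrom lo (fromGaps lo ds))
descFrom-fromGaps lo []       = tt
descFrom-fromGaps lo (d ∷ ds) = descFrom-∷⁺ (fromGaps lo ds) (head-fromGaps-≥ lo d ds)
  (descIn-fromGaps lo _ ds (ℕP.+-monoˡ-≤ (sum ds) (ℕP.m≤m+n (lo ℕ.+ length ds) d)))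

length-fromGaps : ∀ lo ds → length (fromGaps lo ds) ≡ length ds
length-fromGaps lo []       = refl
length-fromGaps lo (d ∷ ds) = cong suc (length-fromGaps lo ds)

length-toGaps : ∀ lo xs → length (toGaps lo xs) ≡ length xs
length-toGaps lo []           = refl
length-toGaps lo (y ∷ [])     = refl
length-toGaps lo (y ∷ z ∷ zs) = cong suc (length-toGaps lo (z ∷ zs))

multiplicityWeight-suc : ∀ o ds → multiplicityWeight (suc o) ds ≡ multiplicityWeight o ds ℕ.+ sum ds
multiplicityWeight-suc o []       = refl
multiplicityWeight-suc o (d ∷ ds) =
  trans (cong (d ℕ.* suc (suc o) ℕ.+_) (multiplicityWeight-suc (suc o) ds))
        (ℕsolve 4 (λ d o w s → d :*ℕ (conℕ 1 :+ℕ (conℕ 1 :+ℕ o)) :+ℕ (w :+ℕ s) :=ℕ (d :*ℕ (conℕ 1 :+ℕ o) :+ℕ w) :+ℕ (d :+ℕ s))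
                  refl d o (multiplicityWeight (suc o) ds) (sum ds))

sum-fromGaps : ∀ lo ds → sum (fromGaps lo ds) ≡ length ds ℕ.* lo ℕ.+ length ds C 2 ℕ.+ multiplicityWeight 0 ds
sum-fromGaps lo []       = refl
sum-fromGaps lo (d ∷ ds) = begin
  (lo ℕ.+ r ℕ.+ d ℕ.+ sum ds) ℕ.+ sum (fromGaps lo ds)
    ≡⟨ cong ((lo ℕ.+ r ℕ.+ d ℕ.+ sum ds) ℕ.+_) (sum-fromGaps lo ds) ⟩
  (lo ℕ.+ r ℕ.+ d ℕ.+ sum ds) ℕ.+ (r ℕ.* lo ℕ.+ r C 2 ℕ.+ multiplicityWeight 0 ds)
    ≡⟨ ℕsolve 6 (λ lo r d s c w → (lo :+ℕ r :+ℕ d :+ℕ s) :+ℕ (r :*ℕ lo :+ℕ c :+ℕ w)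
                   :=ℕ (conℕ 1 :+ℕ r) :*ℕ lo :+ℕ (c :+ℕ r) :+ℕ (d :*ℕ conℕ 1 :+ℕ (w :+ℕ s)))
              refl lo r d (sum ds) (r C 2) (multiplicityWeight 0 ds) ⟩
  suc r ℕ.* lo ℕ.+ (r C 2 ℕ.+ r) ℕ.+ (d ℕ.* 1 ℕ.+ (multiplicityWeight 0 ds ℕ.+ sum ds))
    ≡⟨ cong₂ (λ x y → suc r ℕ.* lo ℕ.+ x ℕ.+ (d ℕ.* 1 ℕ.+ y)) (sym (C2-suc r)) (sym (multiplicityWeight-suc 0 ds)) ⟩
  suc r ℕ.* lo ℕ.+ suc r C 2 ℕ.+ multiplicityWeight 0 (d ∷ ds) ∎
  where
  open ≡-Reasoning
  r = length ds

toGaps∘fromGaps : ∀ lo ds → toGaps lo (fromGaps lo ds) ≡ ds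
toGaps∘fromGaps lo []            = refl
toGaps∘fromGaps lo (d ∷ [])      =
  cong (_∷ []) (trans (cong (_∸ lo) (trans (ℕP.+-identityʳ _) (cong (ℕ._+ d) (ℕP.+-identityʳ lo)))) (ℕP.m+n∸m≡n lo d))
toGaps∘fromGaps lo (d ∷ d′ ∷ ds) =
  cong₂ _∷_ (trans (cong (_∸ suc z) rearrange) (ℕP.m+n∸m≡n (suc z) d)) (toGaps∘fromGaps lo (d′ ∷ ds))
  where
  z = lo ℕ.+ length ds ℕ.+ d′ ℕ.+ sum ds
  rearrange : lo ℕ.+ suc (length ds) ℕ.+ d ℕ.+ (d′ ℕ.+ sum ds) ≡ suc z ℕ.+ d
  rearrange = ℕsolve 5 (λ lo l d d′ s → lo :+ℕ (conℕ 1 :+ℕ l) :+ℕ d :+ℕ (d′ :+ℕ s) :=ℕ (conℕ 1 :+ℕ (lo :+ℕ l :+ℕ d′ :+ℕ s)) :+ℕ d)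
                       refl lo (length ds) d d′ (sum ds)

fromGaps∘toGaps : ∀ lo xs → T (descFrom lo xs) → fromGaps lo (toGaps lo xs) ≡ xs
fromGaps∘toGaps lo []           _ = refl
fromGaps∘toGaps lo (y ∷ [])     p =
  cong (_∷ []) (trans (trans (ℕP.+-identityʳ _) (cong (ℕ._+ (y ∸ lo)) (ℕP.+-identityʳ lo)))
                      (ℕP.m+[n∸m]≡n (proj₁ (descFrom-∷⁻ lo y [] p))))
fromGaps∘toGaps lo (y ∷ z ∷ zs) p = prepend (toGaps lo (z ∷ zs)) (fromGaps∘toGaps lo (z ∷ zs) (descFrom-∷⁺ zs lo≤z zs↓))
  where
  tail↓ = proj₂ (descFrom-∷⁻ lo y (z ∷ zs) p)
  lo≤z = proj₁ (descIn-∷⁻ lo y z zs tail↓)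
  z<y  = proj₁ (proj₂ (descIn-∷⁻ lo y z zs tail↓))
  zs↓  = proj₂ (proj₂ (descIn-∷⁻ lo y z zs tail↓))
  prepend : ∀ gs → fromGaps lo gs ≡ z ∷ zs → fromGaps lo ((y ∸ suc z) ∷ gs) ≡ y ∷ z ∷ zs
  prepend []       ()
  prepend (g ∷ gs) e = cong₂ _∷_ (begin
      lo ℕ.+ suc (length gs) ℕ.+ (y ∸ suc z) ℕ.+ (g ℕ.+ sum gs)
        ≡⟨ ℕsolve 5 (λ lo l x g s → lo :+ℕ (conℕ 1 :+ℕ l) :+ℕ x :+ℕ (g :+ℕ s) :=ℕ (conℕ 1 :+ℕ (lo :+ℕ l :+ℕ g :+ℕ s)) :+ℕ x)
                    refl lo (length gs) (y ∸ suc z) g (sum gs) ⟩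
      suc (lo ℕ.+ length gs ℕ.+ g ℕ.+ sum gs) ℕ.+ (y ∸ suc z)
        ≡⟨ cong (λ w → suc w ℕ.+ (y ∸ suc z)) (∷-injectiveˡ e) ⟩
      suc z ℕ.+ (y ∸ suc z)
        ≡⟨ ℕP.m+[n∸m]≡n z<y ⟩
      y ∎) e
    where open ≡-Reasoning

distinctPartsFrom : ℕ → ℕ → WeightedSet
distinctPartsFrom lo r = weightedSet (List ℕ) (λ xs → descFrom lo xs ∧ (length xs ≡ᵇ r)) sum

distinctPartsFrom-enumerates : ∀ lo r → (qpow (r ℕ.* lo ℕ.+ r C 2) ⊛ invQQPoch r) Enumerates distinctPartsFrom lo r
distinctPartsFrom-enumerates lo r =
  enumerates-≅ (enumerates-⊛ (qpow-enumerates (r ℕ.* lo ℕ.+ r C 2))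
                             (enumerates-≋ (invOneMinusQ-product-enumerates r 0) (≋-sym (prodPS≋prodPS′ r invOneMinusQ))))
  record
    { to = λ (_ , ds) → fromGaps lo ds
    ; from = λ xs → tt , toGaps lo xs
    ; to-valid = λ (_ , ds) p → T-∧-intro (descFrom-fromGaps lo ds) (subst (λ l → T (l ≡ᵇ r)) (sym (length-fromGaps lo ds)) p)
    ; from-valid = λ xs p → subst (λ l → T (l ≡ᵇ r)) (sym (length-toGaps lo xs)) (T-∧-snd {descFrom lo xs} p)
    ; to-weight = λ (_ , ds) p → trans (sum-fromGaps lo ds)
                                        (cong (λ l → l ℕ.* lo ℕ.+ l C 2 ℕ.+ multiplicityWeight 0 ds) (ℕP.≡ᵇ⇒≡ (length ds) r p))
    ; from∘to = λ (_ , ds) _ → cong (tt ,_) (toGaps∘fromGaps lo ds)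
    ; to∘from = λ xs p → fromGaps∘toGaps lo xs (T-∧-fst p) }

descIn-mono : ∀ lo {hi hi′} xs → hi ≤ hi′ → T (descIn lo hi xs) → T (descIn lo hi′ xs)
descIn-mono lo []       _     _ = tt
descIn-mono lo {hi} (y ∷ ys) hi≤hi′ p =
  let (lo≤y , y<hi , ys↓) = descIn-∷⁻ lo hi y ys p in descIn-∷⁺ ys lo≤y (ℕP.<-≤-trans y<hi hi≤hi′) ys↓

descIn-empty : ∀ lo xs → T (descIn lo lo xs) → xs ≡ []
descIn-empty lo []       _ = refl
descIn-empty lo (y ∷ ys) p = let (lo≤y , y<lo , _) = descIn-∷⁻ lo lo y ys p in ⊥-elim (ℕP.<-irrefl refl (ℕP.≤-<-trans lo≤y y<lo))

splitTop : ℕ → List ℕ → List ℕ ⊎ List ℕ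
splitTop v []       = inj₁ []
splitTop v (y ∷ ys) with y ℕP.≟ v
... | yes _ = inj₂ ys
... | no _  = inj₁ (y ∷ ys)

joinTop : ℕ → List ℕ ⊎ List ℕ → List ℕ
joinTop v (inj₁ xs) = xs
joinTop v (inj₂ xs) = v ∷ xs

joinTop∘splitTop : ∀ v xs → joinTop v (splitTop v xs) ≡ xs
joinTop∘splitTop v []       = refl
joinTop∘splitTop v (y ∷ ys) with y ℕP.≟ v
... | yes refl = refl
... | no _     = refl

splitTop-inj₁ : ∀ lo v xs → T (descIn lo v xs) → splitTop v xs ≡ inj₁ xs
splitTop-inj₁ lo v []       p = refl
splitTop-inj₁ lo v (y ∷ ys) p with y ℕP.≟ v
... | yes refl = ⊥-elim (ℕP.<-irrefl refl (proj₁ (proj₂ (descIn-∷⁻ lo y y ys p))))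
... | no _     = refl

splitTop-inj₂ : ∀ v xs → splitTop v (v ∷ xs) ≡ inj₂ xs
splitTop-inj₂ v xs with v ℕP.≟ v
... | yes _  = refl
... | no v≢v = ⊥-elim (v≢v refl)

data SplitTopView (lo v : ℕ) (xs : List ℕ) : Set where
  without : ∀ ys → splitTop v xs ≡ inj₁ ys → T (descIn lo v ys) → length ys ≡ length xs → SplitTopView lo v xs
  with-v  : ∀ ys → splitTop v xs ≡ inj₂ ys → T (descIn lo v ys) → suc (length ys) ≡ length xs → SplitTopView lo v xs

splitTop-view : ∀ lo v xs → T (descIn lo (suc v) xs) → SplitTopView lo v xs
splitTop-view lo v []       p = without [] refl tt refl
splitTop-view lo v (y ∷ ys) p with y ℕP.≟ v
... | yes refl = with-v ys (splitTop-inj₂ v ys) (proj₂ (proj₂ (descIn-∷⁻ lo (suc v) y ys p))) refl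
... | no y≢v   = without (y ∷ ys) (splitTop-inj₁ lo v (y ∷ ys) xs↓) xs↓ refl
  where
  xs↓ : T (descIn lo v (y ∷ ys))
  xs↓ = let (lo≤y , y≤v , ys↓) = descIn-∷⁻ lo (suc v) y ys p in descIn-∷⁺ ys lo≤y (ℕP.≤∧≢⇒< (ℕP.≤-pred y≤v) y≢v) ys↓

distinctPartsUpTo : ℕ → WeightedSet
distinctPartsUpTo r = weightedSet (List ℕ) (descIn 1 (suc r)) sum

negQQPoch-enumerates : ∀ r → negQQPoch r Enumerates distinctPartsUpTo r
negQQPoch-enumerates zero    = enumerates-≅ (qpow-enumerates 0) (singleton≅ [] refl tt (descIn-empty 1))
negQQPoch-enumerates (suc r) =
  enumerates-≅ (enumerates-⊛ (negQQPoch-enumerates r) (enumerates-⊕ (qpow-enumerates 0) (qpow-enumerates (suc r)))) record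
    { to = to
    ; from = from ∘ splitTop (suc r)
    ; to-valid = λ { (xs , inj₁ _) p → descIn-mono 1 xs (ℕP.n≤1+n _) (T-∧-fst p)
                   ; (xs , inj₂ _) p → descIn-∷⁺ xs (s≤s z≤n) ℕP.≤-refl (T-∧-fst p) }
    ; from-valid = from-valid
    ; to-weight = λ { (xs , inj₁ _) _ → sym (ℕP.+-identityʳ (sum xs)) ; (xs , inj₂ _) _ → ℕP.+-comm (suc r) (sum xs) }
    ; from∘to = λ { (xs , inj₁ _) p → cong from (splitTop-inj₁ 1 (suc r) xs (T-∧-fst p))
                  ; (xs , inj₂ _) _ → cong from (splitTop-inj₂ (suc r) xs) }
    ; to∘from = λ xs _ → trans (to∘from (splitTop (suc r) xs)) (joinTop∘splitTop (suc r) xs) }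
  where
  from : List ℕ ⊎ List ℕ → List ℕ × (⊤ ⊎ ⊤)
  from (inj₁ xs) = xs , inj₁ tt
  from (inj₂ xs) = xs , inj₂ tt
  to : List ℕ × (⊤ ⊎ ⊤) → List ℕ
  to (xs , inj₁ _) = xs
  to (xs , inj₂ _) = suc r ∷ xs
  to∘from : ∀ s → to (from s) ≡ joinTop (suc r) s
  to∘from (inj₁ _) = refl
  to∘from (inj₂ _) = refl
  from-valid : ∀ xs → T (descIn 1 (suc (suc r)) xs) → T (valid (distinctPartsUpTo r ×ʷ (point 0 ⊎ʷ point (suc r))) (from (splitTop (suc r) xs)))
  from-valid xs p with splitTop-view 1 (suc r) xs p
  ... | without ys e ys↓ _ rewrite e = T-∧-intro ys↓ tt
  ... | with-v  ys e ys↓ _ rewrite e = T-∧-intro ys↓ tt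

distinctPartsIn : ℕ → ℕ → ℕ → WeightedSet
distinctPartsIn lo a b = weightedSet (List ℕ) (λ xs → descIn lo (a ℕ.+ lo) xs ∧ (length xs ≡ᵇ b)) sum

distinctPartsIn-empty : ∀ lo b xs → ¬ T (valid (distinctPartsIn lo 0 (suc b)) xs)
distinctPartsIn-empty lo b xs p with descIn-empty lo xs (T-∧-fst p)
distinctPartsIn-empty lo b [] p | refl = T-∧-snd {true} p

subsetSumGF-shift-⊕ : ∀ lo a b → qpow (suc b ℕ.* lo) ⊛ subsetSumGF (suc a) (suc b) ≋
  (qpow (suc b ℕ.* lo) ⊛ subsetSumGF a (suc b)) ⊕ (qpow (a ℕ.+ lo) ⊛ (qpow (b ℕ.* lo) ⊛ subsetSumGF a b))
subsetSumGF-shift-⊕ lo a b = begin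
  L ⊛ (subsetSumGF a (suc b) ⊕ (qpow a ⊛ G₀))
    ≈⟨ ⊛-distribˡ L (subsetSumGF a (suc b)) (qpow a ⊛ G₀) ⟩
  (L ⊛ subsetSumGF a (suc b)) ⊕ (L ⊛ (qpow a ⊛ G₀))
    ≈⟨ ⊕-congʳ (L ⊛ subsetSumGF a (suc b)) (⊛-congˡ (qpow a ⊛ G₀) (≋-sym (qpow-⊛-qpow lo (b ℕ.* lo)))) ⟩
  (L ⊛ subsetSumGF a (suc b)) ⊕ ((qpow lo ⊛ qpow (b ℕ.* lo)) ⊛ (qpow a ⊛ G₀))
    ≈⟨ ⊕-congʳ (L ⊛ subsetSumGF a (suc b))
               (solve 4 (λ L B A g → (L :* B) :* (A :* g) := (A :* L) :* (B :* g)) ≋-refl (qpow lo) (qpow (b ℕ.* lo)) (qpow a) G₀) ⟩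
  (L ⊛ subsetSumGF a (suc b)) ⊕ ((qpow a ⊛ qpow lo) ⊛ (qpow (b ℕ.* lo) ⊛ G₀))
    ≈⟨ ⊕-congʳ (L ⊛ subsetSumGF a (suc b)) (⊛-congˡ (qpow (b ℕ.* lo) ⊛ G₀) (qpow-⊛-qpow a lo)) ⟩
  (L ⊛ subsetSumGF a (suc b)) ⊕ (qpow (a ℕ.+ lo) ⊛ (qpow (b ℕ.* lo) ⊛ G₀)) ∎
  where
  open SetoidReasoning PS-setoid
  L = qpow (suc b ℕ.* lo)
  G₀ = subsetSumGF a b

distinctPartsIn-enumerates : ∀ lo a b → (qpow (b ℕ.* lo) ⊛ subsetSumGF a b) Enumerates distinctPartsIn lo a b
distinctPartsIn-enumerates lo a zero =
  enumerates-≅ (enumerates-≋ (qpow-enumerates 0) (≋-sym (⊛-identityʳ (qpow 0))))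
               (singleton≅ [] refl tt (λ xs p → length≡0 xs (T-∧-snd {descIn lo (a ℕ.+ lo) xs} p)))
distinctPartsIn-enumerates lo zero (suc b) =
  enumerates-≅ (enumerates-≋ zeroPS-enumerates (≋-sym (⊛-zeroʳ (qpow (suc b ℕ.* lo))))) record
    { to = λ _ → [] ; from = λ _ → tt ; to-valid = λ _ () ; from-valid = λ xs p → ⊥-elim (distinctPartsIn-empty lo b xs p)
    ; to-weight = λ _ () ; from∘to = λ _ () ; to∘from = λ xs p → ⊥-elim (distinctPartsIn-empty lo b xs p) }
distinctPartsIn-enumerates lo (suc a) (suc b) =
  enumerates-≅ (enumerates-≋ (enumerates-⊕ (distinctPartsIn-enumerates lo a (suc b))
                                           (enumerates-⊛ (qpow-enumerates v) (distinctPartsIn-enumerates lo a b)))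
                             (≋-sym (subsetSumGF-shift-⊕ lo a b))) record
    { to = to
    ; from = from ∘ splitTop v
    ; to-valid = to-valid
    ; from-valid = from-valid
    ; to-weight = λ { (inj₁ _) _ → refl ; (inj₂ _) _ → refl }
    ; from∘to = λ { (inj₁ xs) p → cong from (splitTop-inj₁ lo v xs (T-∧-fst p)) ; (inj₂ (_ , xs)) _ → cong from (splitTop-inj₂ v xs) }
    ; to∘from = λ xs p → trans (to∘from (splitTop v xs)) (joinTop∘splitTop v xs) }
  where
  v = a ℕ.+ lo
  Source = distinctPartsIn lo a (suc b) ⊎ʷ (point v ×ʷ distinctPartsIn lo a b)
  to : Elem Source → List ℕ
  to (inj₁ xs)       = xs
  to (inj₂ (_ , xs)) = v ∷ xs
  from : List ℕ ⊎ List ℕ → Elem Source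
  from (inj₁ xs) = inj₁ xs
  from (inj₂ xs) = inj₂ (tt , xs)
  to∘from : ∀ s → to (from s) ≡ joinTop v s
  to∘from (inj₁ _) = refl
  to∘from (inj₂ _) = refl
  to-valid : ∀ s → T (valid Source s) → T (valid (distinctPartsIn lo (suc a) (suc b)) (to s))
  to-valid (inj₁ xs) p =
    T-∧-intro (descIn-mono lo xs (ℕP.n≤1+n _) (T-∧-fst p)) (T-∧-snd {descIn lo v xs} p)
  to-valid (inj₂ (_ , xs)) p =
    T-∧-intro (descIn-∷⁺ xs (ℕP.m≤n+m lo a) ℕP.≤-refl (T-∧-fst p)) (T-∧-snd {descIn lo v xs} p)
  from-valid : ∀ xs → T (valid (distinctPartsIn lo (suc a) (suc b)) xs) → T (valid Source (from (splitTop v xs)))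
  from-valid xs p with splitTop-view lo v xs (T-∧-fst p)
  ... | without ys e ys↓ len rewrite e = T-∧-intro ys↓ (subst (λ l → T (l ≡ᵇ suc b)) (sym len) (T-∧-snd {descIn lo (suc v) xs} p))
  ... | with-v  ys e ys↓ len rewrite e = T-∧-intro ys↓ (subst (λ l → T (l ≡ᵇ suc b)) (sym len) (T-∧-snd {descIn lo (suc v) xs} p))

isDistinctPartition⇒descFrom : ∀ xs → T (isDistinctPartition xs) → T (descFrom 1 xs)
isDistinctPartition⇒descFrom []           _ = tt
isDistinctPartition⇒descFrom (x ∷ [])     p = T-∧-intro p tt
isDistinctPartition⇒descFrom (x ∷ y ∷ xs) p =
  let y<x = ℕP.<ᵇ⇒< y x (T-∧-fst p)
      (1≤y , xs↓) = descFrom-∷⁻ 1 y xs (isDistinctPartition⇒descFrom (y ∷ xs) (T-∧-snd {y <ᵇ x} p)) in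
  descFrom-∷⁺ (y ∷ xs) (ℕP.≤-trans 1≤y (ℕP.<⇒≤ y<x)) (descIn-∷⁺ xs 1≤y y<x xs↓)

descFrom⇒isDistinctPartition : ∀ xs → T (descFrom 1 xs) → T (isDistinctPartition xs)
descFrom⇒isDistinctPartition []           _ = tt
descFrom⇒isDistinctPartition (x ∷ [])     p = T-∧-fst p
descFrom⇒isDistinctPartition (x ∷ y ∷ xs) p =
  let (1≤y , y<x , xs↓) = descIn-∷⁻ 1 x y xs (proj₂ (descFrom-∷⁻ 1 x (y ∷ xs) p)) in
  T-∧-intro (ℕP.<⇒<ᵇ y<x) (descFrom⇒isDistinctPartition (y ∷ xs) (descFrom-∷⁺ xs 1≤y xs↓))

descIn-++-∷⁻ : ∀ lo hi ys x rest → T (descIn lo hi (ys ++ x ∷ rest)) →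
               T (descIn (suc x) hi ys) × T (descIn lo x rest) × lo ≤ x × x < hi
descIn-++-∷⁻ lo hi []       x rest p = let (lo≤x , x<hi , rest↓) = descIn-∷⁻ lo hi x rest p in tt , rest↓ , lo≤x , x<hi
descIn-++-∷⁻ lo hi (y ∷ ys) x rest p =
  let (_ , y<hi , tail↓) = descIn-∷⁻ lo hi y (ys ++ x ∷ rest) p
      (ys↓ , rest↓ , lo≤x , x<y) = descIn-++-∷⁻ lo y ys x rest tail↓ in
  descIn-∷⁺ ys x<y y<hi ys↓ , rest↓ , lo≤x , ℕP.<-trans x<y y<hi

descIn-++-∷⁺ : ∀ lo hi ys x rest → T (descIn (suc x) hi ys) → T (descIn lo x rest) → lo ≤ x → x < hi →
               T (descIn lo hi (ys ++ x ∷ rest))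
descIn-++-∷⁺ lo hi []       x rest _   rest↓ lo≤x x<hi = descIn-∷⁺ rest lo≤x x<hi rest↓
descIn-++-∷⁺ lo hi (y ∷ ys) x rest y∷ys↓ rest↓ lo≤x x<hi =
  let (x<y , y<hi , ys↓) = descIn-∷⁻ (suc x) hi y ys y∷ys↓ in
  descIn-∷⁺ (ys ++ x ∷ rest) (ℕP.≤-trans lo≤x (ℕP.<⇒≤ x<y)) y<hi (descIn-++-∷⁺ lo y ys x rest ys↓ rest↓ lo≤x x<y)

descFrom-++-∷⁻ : ∀ lo top x rest → T (descFrom lo (top ++ x ∷ rest)) → T (descFrom (suc x) top) × T (descIn lo x rest) × lo ≤ x
descFrom-++-∷⁻ lo []       x rest p = let (lo≤x , rest↓) = descFrom-∷⁻ lo x rest p in tt , rest↓ , lo≤x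
descFrom-++-∷⁻ lo (y ∷ ys) x rest p =
  let (ys↓ , rest↓ , lo≤x , x<y) = descIn-++-∷⁻ lo y ys x rest (proj₂ (descFrom-∷⁻ lo y (ys ++ x ∷ rest) p)) in
  descFrom-∷⁺ ys x<y ys↓ , rest↓ , lo≤x

descFrom-++-∷⁺ : ∀ lo top x rest → T (descFrom (suc x) top) → T (descIn lo x rest) → lo ≤ x → T (descFrom lo (top ++ x ∷ rest))
descFrom-++-∷⁺ lo []       x rest _    rest↓ lo≤x = descFrom-∷⁺ rest lo≤x rest↓
descFrom-++-∷⁺ lo (y ∷ ys) x rest top↓ rest↓ lo≤x =
  let (x<y , ys↓) = descFrom-∷⁻ (suc x) y ys top↓ in
  descFrom-∷⁺ (ys ++ x ∷ rest) (ℕP.≤-trans lo≤x (ℕP.<⇒≤ x<y)) (descIn-++-∷⁺ lo y ys x rest ys↓ rest↓ lo≤x x<y)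

descIn-++⁺ : ∀ lo m hi mid tail → T (descIn m hi mid) → T (descIn lo m tail) → lo ≤ m → m ≤ hi → T (descIn lo hi (mid ++ tail))
descIn-++⁺ lo m hi []       tail _    tail↓ _    m≤hi = descIn-mono lo tail m≤hi tail↓
descIn-++⁺ lo m hi (y ∷ ys) tail mid↓ tail↓ lo≤m m≤hi =
  let (m≤y , y<hi , ys↓) = descIn-∷⁻ m hi y ys mid↓ in
  descIn-∷⁺ (ys ++ tail) (ℕP.≤-trans lo≤m m≤y) y<hi (descIn-++⁺ lo m y ys tail ys↓ tail↓ lo≤m m≤y)

length-descIn : ∀ lo hi xs → T (descIn lo hi xs) → length xs ≤ hi ∸ lo
length-descIn lo hi []       _ = z≤n
length-descIn lo hi (y ∷ ys) p =
  let (lo≤y , y<hi , ys↓) = descIn-∷⁻ lo hi y ys p in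
  ℕP.≤-trans (s≤s (length-descIn lo y ys ys↓))
             (ℕP.≤-trans (ℕP.≤-reflexive (sym (ℕP.+-∸-assoc 1 lo≤y))) (ℕP.∸-monoˡ-≤ lo y<hi))

atLeast? : ∀ m → Relation.Unary.Decidable (m ≤_)
atLeast? m = m ℕP.≤?_

takeWhile-≤ : ∀ {m y} ys → m ≤ y → takeWhile (atLeast? m) (y ∷ ys) ≡ y ∷ takeWhile (atLeast? m) ys
takeWhile-≤ {m} {y} ys m≤y with m ≤ᵇ y | ℕP.≤ᵇ-reflects-≤ m y
... | true  | _       = refl
... | false | ofⁿ m≰y = ⊥-elim (m≰y m≤y)

takeWhile-> : ∀ {m y} ys → y < m → takeWhile (atLeast? m) (y ∷ ys) ≡ []
takeWhile-> {m} {y} ys y<m with m ≤ᵇ y | ℕP.≤ᵇ-reflects-≤ m y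
... | true  | ofʸ m≤y = ⊥-elim (ℕP.<-irrefl refl (ℕP.<-≤-trans y<m m≤y))
... | false | _       = refl

dropWhile-≤ : ∀ {m y} ys → m ≤ y → dropWhile (atLeast? m) (y ∷ ys) ≡ dropWhile (atLeast? m) ys
dropWhile-≤ {m} {y} ys m≤y with m ≤ᵇ y | ℕP.≤ᵇ-reflects-≤ m y
... | true  | _       = refl
... | false | ofⁿ m≰y = ⊥-elim (m≰y m≤y)

dropWhile-> : ∀ {m y} ys → y < m → dropWhile (atLeast? m) (y ∷ ys) ≡ y ∷ ys
dropWhile-> {m} {y} ys y<m with m ≤ᵇ y | ℕP.≤ᵇ-reflects-≤ m y
... | true  | ofʸ m≤y = ⊥-elim (ℕP.<-irrefl refl (ℕP.<-≤-trans y<m m≤y))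
... | false | _       = refl

takeWhile-descIn : ∀ lo m hi xs → T (descIn lo hi xs) → T (descIn m hi (takeWhile (atLeast? m) xs))
takeWhile-descIn lo m hi []       _ = tt
takeWhile-descIn lo m hi (y ∷ ys) p with descIn-∷⁻ lo hi y ys p | m ℕP.≤? y
... | (_ , y<hi , ys↓) | yes m≤y rewrite takeWhile-≤ ys m≤y =
  descIn-∷⁺ (takeWhile (atLeast? m) ys) m≤y y<hi (takeWhile-descIn lo m y ys ys↓)
... | _                | no m≰y rewrite takeWhile-> ys (ℕP.≰⇒> m≰y) = tt

dropWhile-descIn : ∀ lo m hi xs → T (descIn lo hi xs) → T (descIn lo m (dropWhile (atLeast? m) xs))
dropWhile-descIn lo m hi []       _ = tt
dropWhile-descIn lo m hi (y ∷ ys) p with descIn-∷⁻ lo hi y ys p | m ℕP.≤? y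
... | (_ , _ , ys↓)    | yes m≤y rewrite dropWhile-≤ ys m≤y = dropWhile-descIn lo m y ys ys↓
... | (lo≤y , _ , ys↓) | no m≰y rewrite dropWhile-> ys (ℕP.≰⇒> m≰y) = descIn-∷⁺ ys lo≤y (ℕP.≰⇒> m≰y) ys↓

takeWhile-++ : ∀ lo m hi mid tail → T (descIn m hi mid) → T (descIn lo m tail) → takeWhile (atLeast? m) (mid ++ tail) ≡ mid
takeWhile-++ lo m hi []       []       _    _     = refl
takeWhile-++ lo m hi []       (y ∷ ys) _    tail↓ = takeWhile-> ys (proj₁ (proj₂ (descIn-∷⁻ lo m y ys tail↓)))
takeWhile-++ lo m hi (y ∷ ys) tail     mid↓ tail↓ =
  let (m≤y , _ , ys↓) = descIn-∷⁻ m hi y ys mid↓ in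
  trans (takeWhile-≤ (ys ++ tail) m≤y) (cong (y ∷_) (takeWhile-++ lo m y ys tail ys↓ tail↓))

dropWhile-++ : ∀ lo m hi mid tail → T (descIn m hi mid) → T (descIn lo m tail) → dropWhile (atLeast? m) (mid ++ tail) ≡ tail
dropWhile-++ lo m hi []       []       _    _     = refl
dropWhile-++ lo m hi []       (y ∷ ys) _    tail↓ = dropWhile-> ys (proj₁ (proj₂ (descIn-∷⁻ lo m y ys tail↓)))
dropWhile-++ lo m hi (y ∷ ys) tail     mid↓ tail↓ =
  let (m≤y , _ , ys↓) = descIn-∷⁻ m hi y ys mid↓ in
  trans (dropWhile-≤ (ys ++ tail) m≤y) (dropWhile-++ lo m y ys tail ys↓ tail↓)

-- splitAtPart r λ = ((λ₁, …, λ_r), λ_{r+1}, (λ_{r+2}, …)), with junk 0 and [] when λ is too short.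
splitAtPart : ℕ → List ℕ → List ℕ × ℕ × List ℕ
splitAtPart zero    []       = [] , 0 , []
splitAtPart zero    (y ∷ ys) = [] , y , ys
splitAtPart (suc r) []       = [] , 0 , []
splitAtPart (suc r) (y ∷ ys) = let (top , x , rest) = splitAtPart r ys in y ∷ top , x , rest

part-splitAtPart : ∀ r xs → part xs (suc r) ≡ proj₁ (proj₂ (splitAtPart r xs))
part-splitAtPart zero    []       = refl
part-splitAtPart zero    (y ∷ ys) = refl
part-splitAtPart (suc r) []       = refl
part-splitAtPart (suc r) (y ∷ ys) = part-splitAtPart r ys

splitAtPart-++ : ∀ r xs → let (top , x , rest) = splitAtPart r xs in 1 ≤ x → top ++ x ∷ rest ≡ xs × length top ≡ r
splitAtPart-++ zero    (y ∷ ys) _   = refl , refl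
splitAtPart-++ (suc r) (y ∷ ys) 1≤x = let (app , len) = splitAtPart-++ r ys 1≤x in cong (y ∷_) app , cong suc len

splitAtPart-inverse : ∀ top x rest → splitAtPart (length top) (top ++ x ∷ rest) ≡ (top , x , rest)
splitAtPart-inverse []       x rest = refl
splitAtPart-inverse (y ∷ ys) x rest rewrite splitAtPart-inverse ys x rest = refl

conj-++ : ∀ xs ys j → conj (xs ++ ys) j ≡ conj xs j ℕ.+ conj ys j
conj-++ xs ys j = trans (cong sum (map-++ indicator xs ys)) (sum-++ (map indicator xs) (map indicator ys))
  where
  indicator : ℕ → ℕ
  indicator x = if j ≤ᵇ x then 1 else 0

indicator-≤ : ∀ {j x} → j ≤ x → (if j ≤ᵇ x then 1 else 0) ≡ 1
indicator-≤ {j} {x} j≤x with j ≤ᵇ x | ℕP.≤ᵇ-reflects-≤ j x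
... | true  | _       = refl
... | false | ofⁿ j≰x = ⊥-elim (j≰x j≤x)

indicator-> : ∀ {j x} → x < j → (if j ≤ᵇ x then 1 else 0) ≡ 0
indicator-> {j} {x} x<j with j ≤ᵇ x | ℕP.≤ᵇ-reflects-≤ j x
... | true  | ofʸ j≤x = ⊥-elim (ℕP.<-irrefl refl (ℕP.<-≤-trans x<j j≤x))
... | false | _       = refl

conj-descIn-≥ : ∀ j lo hi xs → T (descIn lo hi xs) → j ≤ lo → conj xs j ≡ length xs
conj-descIn-≥ j lo hi []       _ _    = refl
conj-descIn-≥ j lo hi (y ∷ ys) p j≤lo =
  let (lo≤y , _ , ys↓) = descIn-∷⁻ lo hi y ys p in
  cong₂ ℕ._+_ (indicator-≤ (ℕP.≤-trans j≤lo lo≤y)) (conj-descIn-≥ j lo y ys ys↓ j≤lo)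

conj-descIn-< : ∀ j lo hi xs → T (descIn lo hi xs) → hi ≤ j → conj xs j ≡ 0
conj-descIn-< j lo hi []       _ _    = refl
conj-descIn-< j lo hi (y ∷ ys) p hi≤j =
  let (_ , y<hi , ys↓) = descIn-∷⁻ lo hi y ys p in
  cong₂ ℕ._+_ (indicator-> (ℕP.<-≤-trans y<hi hi≤j)) (conj-descIn-< j lo y ys ys↓ (ℕP.≤-trans (ℕP.<⇒≤ y<hi) hi≤j))

conj-descFrom : ∀ j lo xs → T (descFrom lo xs) → j ≤ lo → conj xs j ≡ length xs
conj-descFrom j lo []       _ _    = refl
conj-descFrom j lo (y ∷ ys) p j≤lo =
  let (lo≤y , ys↓) = descFrom-∷⁻ lo y ys p in
  cong₂ ℕ._+_ (indicator-≤ (ℕP.≤-trans j≤lo lo≤y)) (conj-descIn-≥ j lo y ys ys↓ j≤lo)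

indexedUnion : (A : Set) → ℕ → (ℕ → ℕ) → (ℕ → A → Bool) → (ℕ → A → ℕ) → WeightedSet
indexedUnion A n label ok w = weightedSet (ℕ × A) (λ (i , a) → (i <ᵇ n) ∧ ok (label i) a) (λ (i , a) → w (label i) a)

sumPS-enumerates : ∀ {A : Set} n (f g : ℕ → ℕ) (ok : ℕ → A → Bool) (w : ℕ → A → ℕ) (F : ℕ → PS) →
  (∀ i → i < n → F (g (f i)) Enumerates weightedSet A (ok (g (f i))) (w (g (f i)))) →
  sumPS (map g (applyUpTo f n)) F Enumerates indexedUnion A n (g ∘ f) ok w
sumPS-enumerates zero f g ok w F E n =
  0 , refl , mk↔ₛ′ (λ ()) (λ { (_ , () , _) }) (λ { (_ , () , _) }) (λ ())
sumPS-enumerates {A} (suc n) f g ok w F E =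
  enumerates-≅ (enumerates-⊕ (E 0 (s≤s z≤n)) (sumPS-enumerates n (f ∘ suc) g ok w F (λ i i<n → E (suc i) (s≤s i<n)))) record
    { to = to ; from = from
    ; to-valid = λ { (inj₁ _) p → p ; (inj₂ _) p → p }
    ; from-valid = λ { (zero , _) p → p ; (suc _ , _) p → p }
    ; to-weight = λ { (inj₁ _) _ → refl ; (inj₂ _) _ → refl }
    ; from∘to = λ { (inj₁ _) _ → refl ; (inj₂ _) _ → refl }
    ; to∘from = λ { (zero , _) _ → refl ; (suc _ , _) _ → refl } }
  where
  to : A ⊎ (ℕ × A) → ℕ × A
  to (inj₁ a)       = 0 , a
  to (inj₂ (i , a)) = suc i , a
  from : ℕ × A → A ⊎ (ℕ × A)
  from (zero , a)  = inj₁ a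
  from (suc i , a) = inj₂ (i , a)

rowIdx≥1 : ∀ k h → 1 ≤ k → h ℤ.≤ + k ℤ.- + 1 → 1 ≤ rowIdx k h
rowIdx≥1 k -[1+ j ] _   _   = ℕP.≤-trans (s≤s z≤n) (ℕP.m≤n+m (suc j) k)
rowIdx≥1 k (+ j)    k≥1 j≤k-1 = subst (1 ≤_) (sym rowIdx≡) (ℕP.m<n⇒0<n∸m j<k)
  where
  j<k : j < k
  j<k = ℕP.≤-<-trans (ℤP.drop‿+≤+ (subst (+ j ℤ.≤_) (trans (ℤP.m-n≡m⊖n k 1) (ℤP.⊖-≥ k≥1)) j≤k-1))
                     (ℕP.∸-monoʳ-< {k} {1} {0} (s≤s z≤n) k≥1)
  rowIdx≡ : rowIdx k (+ j) ≡ k ∸ j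
  rowIdx≡ = cong ℤ.∣_∣ (trans (ℤP.m-n≡m⊖n k j) (ℤP.⊖-≥ (ℕP.<⇒≤ j<k)))

lowerLimit : ℕ → ℕ
lowerLimit k = (k ℕ.+ 2) / 2

lowerLimit≥1 : ∀ k → 1 ≤ lowerLimit k
lowerLimit≥1 k = ℕD.m≥n⇒m/n>0 {k ℕ.+ 2} {2} (ℕP.m≤n+m 2 k)

lowerLimit≤ : ∀ k → 1 ≤ k → lowerLimit k ≤ k
lowerLimit≤ k k≥1 = ℕP.≤-pred (ℕD.m<n*o⇒m/o<n {k ℕ.+ 2} {suc k} {2} (ℕP.≤-trans (ℕP.≤-reflexive rearrange) (ℕP.+-monoʳ-≤ 2 1+k≤2k)))
  where
  rearrange : suc (k ℕ.+ 2) ≡ 2 ℕ.+ (1 ℕ.+ k)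
  rearrange = ℕsolve 1 (λ k → conℕ 1 :+ℕ (k :+ℕ conℕ 2) :=ℕ conℕ 2 :+ℕ (conℕ 1 :+ℕ k)) refl k
  1+k≤2k : 1 ℕ.+ k ≤ k ℕ.* 2
  1+k≤2k = ℕP.≤-trans (ℕP.+-monoˡ-≤ k k≥1) (ℕP.≤-reflexive (ℕsolve 1 (λ k → k :+ℕ k :=ℕ k :*ℕ conℕ 2) refl k))

lowerLimit-spec : ∀ k → k < lowerLimit k ℕ.* 2
lowerLimit-spec k = ℕP.+-cancelˡ-≤ 1 _ _ (ℕP.≤-trans (ℕP.≤-reflexive (ℕP.+-comm 2 k))
  (ℕP.≤-trans (ℕP.≤-reflexive (ℕD.m≡m%n+[m/n]*n (k ℕ.+ 2) 2)) (ℕP.+-monoˡ-≤ _ (ℕP.≤-pred (ℕD.m%n<n (k ℕ.+ 2) 2)))))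

lowerLimit-least : ∀ k l → k < l ℕ.* 2 → lowerLimit k ≤ l
lowerLimit-least k l k<2l = ℕP.≤-pred (ℕD.m<n*o⇒m/o<n {k ℕ.+ 2} {suc l} {2}
  (ℕP.≤-trans (ℕP.≤-reflexive (cong suc (ℕP.+-comm k 2))) (ℕP.+-monoʳ-≤ 2 k<2l)))

k-l≤l-1 : ∀ k l → k < l ℕ.* 2 → k ∸ l ≤ l ∸ 1
k-l≤l-1 k zero    ()
k-l≤l-1 k (suc l) k<2l = ℕP.≤-trans (ℕP.∸-monoˡ-≤ (suc l) k≤) (ℕP.≤-reflexive (ℕP.m+n∸m≡n (suc l) l))
  where
  k≤ : k ≤ suc l ℕ.+ l
  k≤ = ℕP.≤-pred (ℕP.≤-trans k<2l (ℕP.≤-reflexive (ℕsolve 1 (λ l → (conℕ 1 :+ℕ l) :*ℕ conℕ 2 :=ℕ conℕ 1 :+ℕ ((conℕ 1 :+ℕ l) :+ℕ l)) refl l)))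

part-++-∷ : ∀ top x rest → part (top ++ x ∷ rest) (suc (length top)) ≡ x
part-++-∷ top x rest = trans (part-splitAtPart (length top) _) (cong (proj₁ ∘ proj₂) (splitAtPart-inverse top x rest))

hookLength-++ : ∀ m x top mid tail → T (descFrom (suc x) top) → m ≤ x → T (descIn m x mid) → T (descIn 1 m tail) →
  hookLength (top ++ x ∷ (mid ++ tail)) (suc (length top)) m ≡ (x ∸ m) ℕ.+ length mid ℕ.+ 1
hookLength-++ m x top mid tail top↓ m≤x mid↓ tail↓ =
  cong₂ (λ u v → (u ∸ m) ℕ.+ v ℕ.+ 1) (part-++-∷ top x (mid ++ tail)) leg
  where
  open ≡-Reasoning
  leg : conj (top ++ x ∷ (mid ++ tail)) m ∸ suc (length top) ≡ length mid
  leg = begin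
    conj (top ++ x ∷ (mid ++ tail)) m ∸ suc (length top)
      ≡⟨ cong (_∸ suc (length top)) (conj-++ top (x ∷ (mid ++ tail)) m) ⟩
    (conj top m ℕ.+ ((if m ≤ᵇ x then 1 else 0) ℕ.+ conj (mid ++ tail) m)) ∸ suc (length top)
      ≡⟨ cong (λ z → (conj top m ℕ.+ z) ∸ suc (length top))
              (cong₂ ℕ._+_ (indicator-≤ m≤x) (conj-++ mid tail m)) ⟩
    (conj top m ℕ.+ suc (conj mid m ℕ.+ conj tail m)) ∸ suc (length top)
      ≡⟨ cong₂ (λ a b → (a ℕ.+ suc b) ∸ suc (length top))
               (conj-descFrom m (suc x) top top↓ (ℕP.m≤n⇒m≤1+n m≤x))
               (cong₂ ℕ._+_ (conj-descIn-≥ m m x mid mid↓ ℕP.≤-refl) (conj-descIn-< m 1 m tail tail↓ ℕP.≤-refl)) ⟩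
    (length top ℕ.+ suc (length mid ℕ.+ 0)) ∸ suc (length top)
      ≡⟨ cong (_∸ suc (length top)) (ℕP.+-suc (length top) (length mid ℕ.+ 0)) ⟩
    (suc (length top) ℕ.+ (length mid ℕ.+ 0)) ∸ suc (length top)
      ≡⟨ ℕP.m+n∸m≡n (suc (length top)) (length mid ℕ.+ 0) ⟩
    length mid ℕ.+ 0
      ≡⟨ ℕP.+-identityʳ (length mid) ⟩
    length mid ∎

hookPartitions : ℕ → ℕ → ℕ → WeightedSet
hookPartitions m k s = weightedSet (List ℕ)
  (λ xs → isDistinctPartition xs ∧ ((1 ≤ᵇ s) ∧ ((m ≤ᵇ part xs s) ∧ (hookLength xs s m ≡ᵇ k)))) sum

hookSummand : ℕ → ℕ → ℕ → ℕ → PS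
hookSummand m k s l = qpow (expo m k s l) ⊛ negQQPoch (m ∸ 1) ⊛ invQQPoch (s ∸ 1) ⊛ qBinom (l ∸ 1) (k ∸ l)

-- The parameters are m′ = m - 1 and r = s - 1, so that λ_s = m′ + l involves no truncated subtraction.
module HookDecomposition (m′ k r : ℕ) (k≥1 : 1 ≤ k) where

  m = suc m′
  s = suc r
  lo = lowerLimit k
  count = suc k ∸ lo

  Blocks : Set
  Blocks = ((⊤ × List ℕ) × List ℕ) × List ℕ

  blocks : ℕ → WeightedSet
  blocks l = ((point (m′ ℕ.+ l) ×ʷ distinctPartsUpTo m′) ×ʷ distinctPartsFrom (suc (m′ ℕ.+ l)) r) ×ʷ distinctPartsIn m (l ∸ 1) (k ∸ l)

  expo-split : ∀ l′ → suc l′ ≤ k → let l = suc l′ ; b = k ∸ l in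
    expo m k s l ≡ (m′ ℕ.+ l) ℕ.+ (r ℕ.* suc (m′ ℕ.+ l) ℕ.+ r C 2) ℕ.+ (b ℕ.* m ℕ.+ b C 2)
  expo-split l′ l≤k = begin
    k ℕ.+ l ℕ.* r ℕ.+ m′ ℕ.* (k ℕ.+ s ∸ l) ℕ.+ s C 2 ℕ.+ b C 2
      ≡⟨ cong (λ u → u ℕ.+ l ℕ.* r ℕ.+ m′ ℕ.* (k ℕ.+ s ∸ l) ℕ.+ s C 2 ℕ.+ b C 2) (sym (ℕP.m+[n∸m]≡n l≤k)) ⟩
    (l ℕ.+ b) ℕ.+ l ℕ.* r ℕ.+ m′ ℕ.* (k ℕ.+ s ∸ l) ℕ.+ s C 2 ℕ.+ b C 2
      ≡⟨ cong₂ (λ v w → (l ℕ.+ b) ℕ.+ l ℕ.* r ℕ.+ m′ ℕ.* v ℕ.+ w ℕ.+ b C 2) (ℕP.+-∸-comm s l≤k) (C2-suc r) ⟩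
    (l ℕ.+ b) ℕ.+ l ℕ.* r ℕ.+ m′ ℕ.* (b ℕ.+ s) ℕ.+ (r C 2 ℕ.+ r) ℕ.+ b C 2
      ≡⟨ ℕsolve 6 (λ l b r m′ c₁ c₂ → (l :+ℕ b) :+ℕ l :*ℕ r :+ℕ m′ :*ℕ (b :+ℕ (conℕ 1 :+ℕ r)) :+ℕ (c₁ :+ℕ r) :+ℕ c₂
                    :=ℕ (m′ :+ℕ l) :+ℕ (r :*ℕ (conℕ 1 :+ℕ (m′ :+ℕ l)) :+ℕ c₁) :+ℕ (b :*ℕ (conℕ 1 :+ℕ m′) :+ℕ c₂))
                 refl l b r m′ (r C 2) (b C 2) ⟩
    (m′ ℕ.+ l) ℕ.+ (r ℕ.* suc (m′ ℕ.+ l) ℕ.+ r C 2) ℕ.+ (b ℕ.* m ℕ.+ b C 2) ∎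
    where
    open ≡-Reasoning
    l = suc l′
    b = k ∸ l

  hookSummand-factorisation : ∀ l′ → suc l′ ≤ k → k ∸ suc l′ ≤ l′ → let l = suc l′ ; b = k ∸ l in
    hookSummand m k s l ≋ ((qpow (m′ ℕ.+ l) ⊛ negQQPoch m′) ⊛ (qpow (r ℕ.* suc (m′ ℕ.+ l) ℕ.+ r C 2) ⊛ invQQPoch r))
                            ⊛ (qpow (b ℕ.* m) ⊛ subsetSumGF l′ b)
  hookSummand-factorisation l′ l≤k b≤l′ = ≋-sym (begin
    ((X ⊛ N) ⊛ (Tp ⊛ I)) ⊛ (B ⊛ subsetSumGF l′ b)
      ≈⟨ ⊛-congʳ ((X ⊛ N) ⊛ (Tp ⊛ I)) (⊛-congʳ B (subsetSumGF≋qBinom l′ b b≤l′)) ⟩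
    ((X ⊛ N) ⊛ (Tp ⊛ I)) ⊛ (B ⊛ (Cb ⊛ Q))
      ≈⟨ solve 7 (λ X N T I B C Q → ((X :* N) :* (T :* I)) :* (B :* (C :* Q)) := ((((X :* T) :* (B :* C)) :* N) :* I) :* Q)
               ≋-refl X N Tp I B Cb Q ⟩
    ((((X ⊛ Tp) ⊛ (B ⊛ Cb)) ⊛ N) ⊛ I) ⊛ Q
      ≈⟨ ⊛-congˡ Q (⊛-congˡ I (⊛-congˡ N exponent)) ⟩
    ((qpow (expo m k s l) ⊛ N) ⊛ I) ⊛ Q ∎)
    where
    open SetoidReasoning PS-setoid
    l = suc l′
    b = k ∸ l
    xe = m′ ℕ.+ l
    te = r ℕ.* suc (m′ ℕ.+ l) ℕ.+ r C 2
    X = qpow xe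
    N = negQQPoch m′
    Tp = qpow te
    I = invQQPoch r
    B = qpow (b ℕ.* m)
    Cb = qpow (b C 2)
    Q = qBinom l′ b
    exponent : (X ⊛ Tp) ⊛ (B ⊛ Cb) ≋ qpow (expo m k s l)
    exponent = ≋-trans (⊛-cong (qpow-⊛-qpow xe te) (qpow-⊛-qpow (b ℕ.* m) (b C 2)))
                       (≋-trans (qpow-⊛-qpow (xe ℕ.+ te) (b ℕ.* m ℕ.+ b C 2)) (qpow-cong (sym (expo-split l′ l≤k))))

  blocks-enumerates : ∀ l → 1 ≤ l → l ≤ k → k ∸ l ≤ l ∸ 1 → hookSummand m k s l Enumerates blocks l
  blocks-enumerates (suc l′) _ l≤k b≤l′ =
    enumerates-≋ (enumerates-⊛ (enumerates-⊛ (enumerates-⊛ (qpow-enumerates (m′ ℕ.+ suc l′)) (negQQPoch-enumerates m′))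
                                             (distinctPartsFrom-enumerates (suc (m′ ℕ.+ suc l′)) r))
                               (distinctPartsIn-enumerates m l′ (k ∸ suc l′)))
                 (≋-sym (hookSummand-factorisation l′ l≤k b≤l′))

  union : WeightedSet
  union = indexedUnion Blocks count (lo ℕ.+_) (valid ∘ blocks) (weight ∘ blocks)

  record BlocksValid (l : ℕ) (tail top mid : List ℕ) : Set where
    field
      tail↓      : T (descIn 1 m tail)
      top↓       : T (descFrom (suc (m′ ℕ.+ l)) top)
      top-length : length top ≡ r
      mid↓       : T (descIn m ((l ∸ 1) ℕ.+ m) mid)
      mid-length : length mid ≡ k ∸ l
  open BlocksValid

  unpack : ∀ l tail top mid → T (valid (blocks l) (((tt , tail) , top) , mid)) → BlocksValid l tail top mid
  unpack l tail top mid p = record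
    { tail↓ = T-∧-fst (T-∧-fst {bTail ∧ (bTop ∧ bTopLength)} p)
    ; top↓ = T-∧-fst (T-∧-snd {bTail} (T-∧-fst {bTail ∧ (bTop ∧ bTopLength)} p))
    ; top-length = ℕP.≡ᵇ⇒≡ _ _ (T-∧-snd {bTop} (T-∧-snd {bTail} (T-∧-fst {bTail ∧ (bTop ∧ bTopLength)} p)))
    ; mid↓ = T-∧-fst (T-∧-snd {bTail ∧ (bTop ∧ bTopLength)} p)
    ; mid-length = ℕP.≡ᵇ⇒≡ _ _ (T-∧-snd {descIn m ((l ∸ 1) ℕ.+ m) mid} (T-∧-snd {bTail ∧ (bTop ∧ bTopLength)} p)) }
    where
    bTail = descIn 1 m tail
    bTop = descFrom (suc (m′ ℕ.+ l)) top
    bTopLength = length top ≡ᵇ r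

  pack : ∀ l tail top mid → BlocksValid l tail top mid → T (valid (blocks l) (((tt , tail) , top) , mid))
  pack l tail top mid v =
    T-∧-intro (T-∧-intro (tail↓ v) (T-∧-intro (top↓ v) (ℕP.≡⇒≡ᵇ _ _ (top-length v))))
              (T-∧-intro (mid↓ v) (ℕP.≡⇒≡ᵇ _ _ (mid-length v)))

  assemble : ℕ × Blocks → List ℕ
  assemble (i , (((_ , tail) , top) , mid)) = top ++ (m′ ℕ.+ (lo ℕ.+ i)) ∷ (mid ++ tail)

  fromParts : List ℕ × ℕ × List ℕ → ℕ × Blocks
  fromParts (top , x , rest) = (x ∸ m′) ∸ lo , (((tt , dropWhile (atLeast? m) rest) , top) , takeWhile (atLeast? m) rest)

  disassemble : List ℕ → ℕ × Blocks
  disassemble = fromParts ∘ splitAtPart r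

  midBound : ∀ l → 1 ≤ l → (l ∸ 1) ℕ.+ m ≡ m′ ℕ.+ l
  midBound (suc l′) _ = ℕsolve 2 (λ m′ l′ → l′ :+ℕ (conℕ 1 :+ℕ m′) :=ℕ m′ :+ℕ (conℕ 1 :+ℕ l′)) refl m′ l′

  m≤x : ∀ l → 1 ≤ l → m ≤ m′ ℕ.+ l
  m≤x (suc l′) _ = ℕP.≤-trans (s≤s (ℕP.m≤m+n m′ l′)) (ℕP.≤-reflexive (sym (ℕP.+-suc m′ l′)))

  hook-arithmetic : ∀ l → 1 ≤ l → l ≤ k → ((m′ ℕ.+ l) ∸ m) ℕ.+ (k ∸ l) ℕ.+ 1 ≡ k
  hook-arithmetic (suc l′) _ l≤k = trans (cong (λ z → z ℕ.+ (k ∸ suc l′) ℕ.+ 1) (trans (cong (_∸ m) (ℕP.+-suc m′ l′)) (ℕP.m+n∸m≡n m′ l′)))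
                                         (trans (ℕP.+-comm (l′ ℕ.+ (k ∸ suc l′)) 1) (ℕP.m+[n∸m]≡n l≤k))

  assembled-valid : ∀ l tail top mid → 1 ≤ l → l ≤ k → BlocksValid l tail top mid →
                    T (valid (hookPartitions m k s) (top ++ (m′ ℕ.+ l) ∷ (mid ++ tail)))
  assembled-valid l tail top mid l≥1 l≤k v =
    T-∧-intro (descFrom⇒isDistinctPartition xs xs↓)
              (T-∧-intro (ℕP.≤⇒≤ᵇ (subst (m ≤_) (sym (part-++-∷′)) (m≤x l l≥1))) (ℕP.≡⇒≡ᵇ _ _ hook))
    where
    x = m′ ℕ.+ l
    xs = top ++ x ∷ (mid ++ tail)
    mid↓′ = subst (λ hi → T (descIn m hi mid)) (midBound l l≥1) (mid↓ v)
    xs↓ : T (descFrom 1 xs)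
    xs↓ = descFrom-++-∷⁺ 1 top x (mid ++ tail) (top↓ v)
            (descIn-++⁺ 1 m x mid tail mid↓′ (tail↓ v) (s≤s z≤n) (m≤x l l≥1)) (ℕP.≤-trans (s≤s z≤n) (m≤x l l≥1))
    part-++-∷′ : part xs s ≡ x
    part-++-∷′ = subst (λ t → part xs (suc t) ≡ x) (top-length v) (part-++-∷ top x (mid ++ tail))
    hook : hookLength xs s m ≡ k
    hook = trans (subst (λ t → hookLength xs (suc t) m ≡ (x ∸ m) ℕ.+ length mid ℕ.+ 1) (top-length v)
                        (hookLength-++ m x top mid tail (top↓ v) (m≤x l l≥1) mid↓′ (tail↓ v)))
                 (trans (cong (λ z → (x ∸ m) ℕ.+ z ℕ.+ 1) (mid-length v)) (hook-arithmetic l l≥1 l≤k))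

  index-range : ∀ i → i < count → 1 ≤ lo ℕ.+ i × lo ℕ.+ i ≤ k × k ∸ (lo ℕ.+ i) ≤ (lo ℕ.+ i) ∸ 1
  index-range i i<count =
    ℕP.≤-trans (lowerLimit≥1 k) (ℕP.m≤m+n lo i) ,
    ℕP.≤-pred (ℕP.≤-trans (ℕP.+-monoʳ-< lo i<count) (ℕP.≤-reflexive (ℕP.m+[n∸m]≡n (ℕP.m≤n⇒m≤1+n (lowerLimit≤ k k≥1))))) ,
    k-l≤l-1 k (lo ℕ.+ i) (ℕP.<-≤-trans (lowerLimit-spec k) (ℕP.*-monoˡ-≤ 2 (ℕP.m≤m+n lo i)))

  assemble-valid : ∀ it → T (valid union it) → T (valid (hookPartitions m k s) (assemble it))
  assemble-valid (i , (((_ , tail) , top) , mid)) p =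
    let (l≥1 , l≤k , _) = index-range i (ℕP.<ᵇ⇒< i count (T-∧-fst p)) in
    assembled-valid (lo ℕ.+ i) tail top mid l≥1 l≤k (unpack (lo ℕ.+ i) tail top mid (T-∧-snd {i <ᵇ count} p))

  assemble-weight : ∀ it → sum (assemble it) ≡ weight union it
  assemble-weight (i , (((_ , tail) , top) , mid)) =
    trans (sum-++ top (x ∷ (mid ++ tail)))
          (trans (cong (λ z → sum top ℕ.+ (x ℕ.+ z)) (sum-++ mid tail))
                 (ℕsolve 4 (λ t x m l → t :+ℕ (x :+ℕ (m :+ℕ l)) :=ℕ ((x :+ℕ l) :+ℕ t) :+ℕ m) refl (sum top) x (sum mid) (sum tail)))
    where x = m′ ℕ.+ (lo ℕ.+ i)

  disassemble∘assemble : ∀ it → T (valid union it) → disassemble (assemble it) ≡ it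
  disassemble∘assemble (i , (((_ , tail) , top) , mid)) p =
    trans (cong fromParts splitAtPart-assemble)
          (cong₂ (λ j (mid′ , tail′) → j , (((tt , tail′) , top) , mid′)) index
                 (cong₂ _,_ (takeWhile-++ 1 m x mid tail mid↓′ (tail↓ v)) (dropWhile-++ 1 m x mid tail mid↓′ (tail↓ v))))
    where
    x = m′ ℕ.+ (lo ℕ.+ i)
    v = unpack (lo ℕ.+ i) tail top mid (T-∧-snd {i <ᵇ count} p)
    l≥1 = proj₁ (index-range i (ℕP.<ᵇ⇒< i count (T-∧-fst p)))
    mid↓′ = subst (λ hi → T (descIn m hi mid)) (midBound (lo ℕ.+ i) l≥1) (mid↓ v)
    splitAtPart-assemble : splitAtPart r (top ++ x ∷ (mid ++ tail)) ≡ (top , x , mid ++ tail)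
    splitAtPart-assemble = subst (λ t → splitAtPart t (top ++ x ∷ (mid ++ tail)) ≡ (top , x , mid ++ tail))
                                 (top-length v) (splitAtPart-inverse top x (mid ++ tail))
    index : (x ∸ m′) ∸ lo ≡ i
    index = trans (cong (_∸ lo) (ℕP.m+n∸m≡n m′ (lo ℕ.+ i))) (ℕP.m+n∸m≡n lo i)

  blocks-of : ∀ top x mid tail → length top ≡ r → T (descFrom (suc x) top) → m ≤ x → T (descIn m x mid) → T (descIn 1 m tail) →
    (x ∸ m) ℕ.+ length mid ℕ.+ 1 ≡ k → Σ (ℕ × Blocks) λ it → T (valid union it) × assemble it ≡ top ++ x ∷ (mid ++ tail)
  blocks-of top x mid tail top-len top↓′ m≤x mid↓′ tail↓′ hook with ℕP.m≤n⇒∃[o]m+o≡n m≤x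
  ... | d , refl = (l ∸ lo , (((tt , tail) , top) , mid)) , valid-it , cong (λ z → top ++ z ∷ (mid ++ tail)) x≡
    where
    L = length mid
    l = suc d
    d+L+1≡k : d ℕ.+ L ℕ.+ 1 ≡ k
    d+L+1≡k = trans (cong (λ z → z ℕ.+ L ℕ.+ 1) (sym (ℕP.m+n∸m≡n m d))) hook
    L≤d : L ≤ d
    L≤d = subst (L ≤_) (ℕP.m+n∸m≡n m d) (length-descIn m (m ℕ.+ d) mid mid↓′)
    l≤k : l ≤ k
    l≤k = subst (l ≤_) d+L+1≡k (ℕP.≤-trans (ℕP.≤-reflexive (ℕP.+-comm 1 d)) (ℕP.+-monoˡ-≤ 1 (ℕP.m≤m+n d L)))
    lo≤l : lo ≤ l
    lo≤l = lowerLimit-least k l (subst (λ z → suc z ≤ l ℕ.* 2) d+L+1≡k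
             (ℕP.≤-trans (s≤s (ℕP.+-monoˡ-≤ 1 (ℕP.+-monoʳ-≤ d L≤d)))
                         (ℕP.≤-reflexive (ℕsolve 1 (λ d → conℕ 1 :+ℕ (d :+ℕ d :+ℕ conℕ 1) :=ℕ (conℕ 1 :+ℕ d) :*ℕ conℕ 2) refl d))))
    lo+[l∸lo]≡l : lo ℕ.+ (l ∸ lo) ≡ l
    lo+[l∸lo]≡l = ℕP.m+[n∸m]≡n lo≤l
    x≡ : m′ ℕ.+ (lo ℕ.+ (l ∸ lo)) ≡ m ℕ.+ d
    x≡ = trans (cong (m′ ℕ.+_) lo+[l∸lo]≡l) (ℕP.+-suc m′ d)
    v : BlocksValid l tail top mid
    v = record
      { tail↓ = tail↓′
      ; top↓ = subst (λ z → T (descFrom (suc z) top)) (sym (ℕP.+-suc m′ d)) top↓′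
      ; top-length = top-len
      ; mid↓ = subst (λ z → T (descIn m z mid)) (ℕP.+-comm m d) mid↓′
      ; mid-length = sym (trans (cong (_∸ l) (sym d+L+1≡k))
                               (trans (cong (_∸ l) (ℕsolve 2 (λ d L → d :+ℕ L :+ℕ conℕ 1 :=ℕ (conℕ 1 :+ℕ d) :+ℕ L) refl d L))
                                      (ℕP.m+n∸m≡n l L))) }
    valid-it : T (valid union (l ∸ lo , (((tt , tail) , top) , mid)))
    valid-it = T-∧-intro (ℕP.<⇒<ᵇ (ℕP.∸-monoˡ-< (s≤s l≤k) lo≤l))
                         (subst (λ z → T (valid (blocks z) (((tt , tail) , top) , mid))) (sym lo+[l∸lo]≡l) (pack l tail top mid v))

  decompose : ∀ xs → T (valid (hookPartitions m k s) xs) → Σ (ℕ × Blocks) λ it → T (valid union it) × assemble it ≡ xs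
  decompose xs p =
    let (it , v , e) = blocks-of top x mid tail top-len top↓′ m≤x′ mid↓′ tail↓′ hook in
    it , v , trans e xs≡
    where
    distinct = T-∧-fst p
    conditions = T-∧-snd {isDistinctPartition xs} p
    top = proj₁ (splitAtPart r xs)
    x = proj₁ (proj₂ (splitAtPart r xs))
    rest = proj₂ (proj₂ (splitAtPart r xs))
    mid = takeWhile (atLeast? m) rest
    tail = dropWhile (atLeast? m) rest
    m≤x′ : m ≤ x
    m≤x′ = subst (m ≤_) (part-splitAtPart r xs) (ℕP.≤ᵇ⇒≤ m _ (T-∧-fst conditions))
    split = splitAtPart-++ r xs (ℕP.≤-trans (s≤s z≤n) m≤x′)
    top-len = proj₂ split
    xs≡ : top ++ x ∷ (mid ++ tail) ≡ xs
    xs≡ = trans (cong (λ z → top ++ x ∷ z) (takeWhile++dropWhile (atLeast? m) rest)) (proj₁ split)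
    pieces = descFrom-++-∷⁻ 1 top x rest (subst (λ z → T (descFrom 1 z)) (sym (proj₁ split)) (isDistinctPartition⇒descFrom xs distinct))
    top↓′ = proj₁ pieces
    rest↓ = proj₁ (proj₂ pieces)
    mid↓′ = takeWhile-descIn 1 m x rest rest↓
    tail↓′ = dropWhile-descIn 1 m x rest rest↓
    hook : (x ∸ m) ℕ.+ length mid ℕ.+ 1 ≡ k
    hook = trans (sym (subst (λ t → hookLength (top ++ x ∷ (mid ++ tail)) (suc t) m ≡ (x ∸ m) ℕ.+ length mid ℕ.+ 1) top-len
                             (hookLength-++ m x top mid tail top↓′ m≤x′ mid↓′ tail↓′)))
                 (trans (cong (λ z → hookLength z s m) xs≡) (ℕP.≡ᵇ⇒≡ _ _ (T-∧-snd {m ≤ᵇ part xs s} conditions)))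

  union≅hookPartitions : union ≅ hookPartitions m k s
  union≅hookPartitions = record
    { to = assemble
    ; from = disassemble
    ; to-valid = assemble-valid
    ; from-valid = λ xs p → let (it , v , e) = decompose xs p in
                   subst (λ z → T (valid union (disassemble z))) e (subst (T ∘ valid union) (sym (disassemble∘assemble it v)) v)
    ; to-weight = λ it _ → assemble-weight it
    ; from∘to = disassemble∘assemble
    ; to∘from = λ xs p → let (it , v , e) = decompose xs p in
                trans (cong (assemble ∘ disassemble) (sym e)) (trans (cong assemble (disassemble∘assemble it v)) e) }

  hookSeries-enumerates : sumPS (range lo k) (hookSummand m k s) Enumerates hookPartitions m k s
  hookSeries-enumerates =
    enumerates-≅ (sumPS-enumerates count (λ i → i) (lo ℕ.+_) (valid ∘ blocks) (weight ∘ blocks) (hookSummand m k s)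
                                   (λ i i<count → let (l≥1 , l≤k , b≤) = index-range i i<count in blocks-enumerates (lo ℕ.+ i) l≥1 l≤k b≤))
                 union≅hookPartitions

Fiber-∧-≡ᵇ : ∀ {A : Set} (p q : A → Bool) (w : A → ℕ) n →
  Fiber (weightedSet A (λ a → p a ∧ q a) w) n ↔ Σ A (λ a → T (p a ∧ ((w a ≡ᵇ n) ∧ q a)))
Fiber-∧-≡ᵇ {A} p q w n = mk↔ₛ′ to from (λ (a , _) → cong (a ,_) (T-irrelevant _ _)) (λ _ → Fiber-≡ W refl)
  where
  W = weightedSet A (λ a → p a ∧ q a) w
  to : Fiber W n → Σ A (λ a → T (p a ∧ ((w a ≡ᵇ n) ∧ q a)))
  to (a , pq , e) = a , T-∧-intro {p a} (T-∧-fst {p a} pq) (T-∧-intro (ℕP.≡⇒≡ᵇ _ _ e) (T-∧-snd {p a} pq))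
  from : Σ A (λ a → T (p a ∧ ((w a ≡ᵇ n) ∧ q a))) → Fiber W n
  from (a , peq) = let eq = T-∧-snd {p a} peq in
    a , T-∧-intro {p a} (T-∧-fst {p a} peq) (T-∧-snd {w a ≡ᵇ n} eq) , ℕP.≡ᵇ⇒≡ _ _ (T-∧-fst eq)

hookSeries-enumerates : ∀ m k s → 1 ≤ m → 1 ≤ k → 1 ≤ s →
  sumPS (range (lowerLimit k) k) (hookSummand m k s) Enumerates hookPartitions m k s
hookSeries-enumerates (suc m′) k (suc r) _ k≥1 _ = HookDecomposition.hookSeries-enumerates m′ k r k≥1

theorem3p4 : (m k : ℕ) (h : ℤ) → 1 ≤ m → 1 ≤ k → h ℤ.≤ (+ k) ℤ.- (+ 1) →
    (n c : ℕ) → (Fin c ↔ Σ (List ℕ) (λ λs → T (goodPartition m k h n λs))) →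
    + c ≡ rhsSeries m k h n
theorem3p4 m k h m≥1 k≥1 h≤k-1 n c c↔partitions =
  trans (cong +_ (Fin-↔⇒≡ (↔-trans c↔partitions (↔-sym (↔-trans c′↔fiber (Fiber-∧-≡ᵇ isDistinctPartition _ sum n))))))
        (sym coefficient)
  where
  enumeration = hookSeries-enumerates m k (rowIdx k h) m≥1 k≥1 (rowIdx≥1 k h k≥1 h≤k-1) n
  coefficient = proj₁ (proj₂ enumeration)
  c′↔fiber = proj₂ (proj₂ enumeration)
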